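{- Let $\mathcal{D}=(\mathcal{P},\mathcal{B},\mathcal{I})$ be a non-trivial $G$-locally primitive $2$-design with $G\le\mathrm{Aut}(\mathcal{D})$, such that $G^{\mathcal{P}}$ is a primitive affine group with socle $N=\mathbb{Z}_p^d$ ($p$ prime, $d\ge1$) and $G^{\mathcal{B}}$ is not quasiprimitive. Then $\mathcal{D}$ is a subdesign of $\mathrm{AG}_i(d,p)$ for some $i$ with $1\le i\le d-1$. In particular, $\mathcal{D}$ is not symmetric.
   Context: A $2$-design has $v\ge2$ points, $b$ blocks, each block incident with $k$ points, any two distinct points incident with exactly $\lambda\ge1$ blocks; non-trivial means $k<v$; symmetric means $v=b$. $\mathcal{D}(\alpha)$ = blocks on $\alpha$, $\mathcal{D}(\beta)$ = points on $\beta$; $G$-locally primitive means $G_\alpha$ is primitive on $\mathcal{D}(\alpha)$ and $G_\beta$ primitive on $\mathcal{D}(\beta)$ for all points $\alpha$ and blocks $\beta$. Quasiprimitive: transitive with all nontrivial normal subgroups transitive. A primitive affine group is a primitive $G\le\mathrm{AGL}(d,p)$ containing the translation group $\mathbb{Z}_p^d$. $\mathrm{AG}_i(d,q)$ is the design with point set $V=\mathbb{F}_q^d$ and blocks all cosets $U+v$ of $i$-dimensional subspaces $U$ of $V$, incidence being membership; $\mathcal{D}$ is a subdesign of it if, up to isomorphism, $\mathcal{P}=\mathbb{F}_q^d$ and $\mathcal{B}$ is a subset of the blocks of $\mathrm{AG}_i(d,q)$ with incidence by membership. -}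

module Defs where

open import Data.Nat using (ℕ; zero; suc; _+_; _*_; _<_; _≤_; NonZero)
open import Data.Nat.DivMod using (_mod_)
open import Data.Fin using (Fin; toℕ) renaming (zero to fz; suc to fs)
open import Data.Bool using (Bool; true; false; if_then_else_; _∧_)
open import Data.Product using (Σ; ∃; _×_; _,_)
open import Data.Sum using (_⊎_)
open import Relation.Binary.PropositionalEquality using (_≡_; _≢_)
open import Function.Definitions using (Bijective)

count : ∀ {n} → (Fin n → Bool) → ℕ
count {zero}  f = 0
count {suc n} f = (if f fz then 1 else 0) + count (λ x → f (fs x))

record Is2Design (v b k lam : ℕ) (I : Fin v → Fin b → Bool) : Set where
  field
    two≤v     : 2 ≤ v
    blockSize : ∀ β → count (λ α → I α β) ≡ k
    pairCount : ∀ α α' → α ≢ α' → count (λ β → I α β ∧ I α' β) ≡ lam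
    one≤lam   : 1 ≤ lam

record Aut {v b : ℕ} (I : Fin v → Fin b → Bool) : Set where
  field
    pt        : Fin v → Fin v
    bl        : Fin b → Fin b
    pt-bij    : Bijective _≡_ _≡_ pt
    bl-bij    : Bijective _≡_ _≡_ bl
    preserves : ∀ α β → I α β ≡ I (pt α) (bl β)

open Aut public

module _ {v b : ℕ} {I : Fin v → Fin b → Bool} where

  IsComp : Aut I → Aut I → Aut I → Set
  IsComp k g h = (∀ α → pt k α ≡ pt g (pt h α)) × (∀ β → bl k β ≡ bl g (bl h β))

  IsId : Aut I → Set
  IsId e = (∀ α → pt e α ≡ α) × (∀ β → bl e β ≡ β)

  -- A subgroup of Aut(D), given as a predicate closed (up to pointwise
  -- equality of the actions) under identity, composition and inverses.
  record IsSubgroup (G : Aut I → Set) : Set where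
    field
      hasId  : ∃ λ e → G e × IsId e
      comp   : ∀ g h → G g → G h → ∃ λ k → G k × IsComp k g h
      inv    : ∀ g → G g → ∃ λ h → G h × (∀ e → IsId e → IsComp e h g)

  record IsNormalSubgroup (G H : Aut I → Set) : Set where
    field
      sub      : ∀ h → H h → G h
      subgroup : IsSubgroup H
      normal   : ∀ g h → G g → H h →
                 ∃ λ h' → H h' × (∀ α → pt h' (pt g α) ≡ pt g (pt h α))
                               × (∀ β → bl h' (bl g β) ≡ bl g (bl h β))

module _ {A X : Set} (H : A → Set) (act : A → X → X) (S : X → Bool) where

  TransitiveOn : Set
  TransitiveOn = ∀ x y → S x ≡ true → S y ≡ true →
                 ∃ λ h → H h × act h x ≡ y

  InvariantEquiv : (X → X → Bool) → Set
  InvariantEquiv R =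
      (∀ x → S x ≡ true → R x x ≡ true)
    × (∀ x y → S x ≡ true → S y ≡ true → R x y ≡ true → R y x ≡ true)
    × (∀ x y z → S x ≡ true → S y ≡ true → S z ≡ true →
         R x y ≡ true → R y z ≡ true → R x z ≡ true)
    × (∀ h x y → H h → S x ≡ true → S y ≡ true → R x y ≡ R (act h x) (act h y))

  TrivialOn : (X → X → Bool) → Set
  TrivialOn R =
      (∀ x y → S x ≡ true → S y ≡ true → R x y ≡ true → x ≡ y)
    ⊎ (∀ x y → S x ≡ true → S y ≡ true → R x y ≡ true)

  PrimitiveOn : Set
  PrimitiveOn = TransitiveOn × (∀ R → InvariantEquiv R → TrivialOn R)

allTrue : {X : Set} → X → Bool
allTrue _ = true

module _ {v b : ℕ} {I : Fin v → Fin b → Bool} where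

  LocallyPrimitive : (Aut I → Set) → Set
  LocallyPrimitive G =
      (∀ α → PrimitiveOn (λ g → G g × pt g α ≡ α) bl (λ β → I α β))
    × (∀ β → PrimitiveOn (λ g → G g × bl g β ≡ β) pt (λ α → I α β))

  BlockQuasiprimitive : (Aut I → Set) → Set₁
  BlockQuasiprimitive G =
      TransitiveOn G bl allTrue
    × (∀ H → IsNormalSubgroup G H →
         (∃ λ h → H h × ∃ λ β → bl h β ≢ β) →
         TransitiveOn H bl allTrue)

module _ (p : ℕ) .{{_ : NonZero p}} where

  _+F_ : Fin p → Fin p → Fin p
  a +F b = (toℕ a + toℕ b) mod p

  _*F_ : Fin p → Fin p → Fin p
  a *F b = (toℕ a * toℕ b) mod p

  0F : Fin p
  0F = 0 mod p

  sumF : ∀ {n} → (Fin n → Fin p) → Fin p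
  sumF {zero}  f = 0F
  sumF {suc n} f = f fz +F sumF (λ j → f (fs j))

  Vect : ℕ → Set
  Vect d = Fin d → Fin p

  _≋_ : ∀ {d} → Vect d → Vect d → Set
  x ≋ y = ∀ j → x j ≡ y j

  _⊕_ : ∀ {d} → Vect d → Vect d → Vect d
  (x ⊕ y) j = x j +F y j

  0V : ∀ {d} → Vect d
  0V _ = 0F

  lincomb : ∀ {d i} → (Fin i → Fin p) → (Fin i → Vect d) → Vect d
  lincomb c u j = sumF (λ l → c l *F u l j)

  LinIndep : ∀ {d i} → (Fin i → Vect d) → Set
  LinIndep u = ∀ c → lincomb c u ≋ 0V → ∀ l → c l ≡ 0F

  Mat : ℕ → Set
  Mat d = Fin d → Fin d → Fin p

  _·_ : ∀ {d} → Mat d → Vect d → Vect d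
  (A · x) j = sumF (λ l → A j l *F x l)

  Invertible : ∀ {d} → Mat d → Set
  Invertible {d} A = ∃ λ (B : Mat d) → (∀ x → (B · (A · x)) ≋ x) × (∀ x → (A · (B · x)) ≋ x)

  module _ {v b : ℕ} {I : Fin v → Fin b → Bool} where

    -- G^P is a primitive affine group with socle the translation group
    -- Z_p^d: under some identification φ of the points with F_p^d, every
    -- element of G acts as x ↦ Ax + c with A ∈ GL(d,p), all translations
    -- are induced by elements of G, and G is primitive on points.
    PrimitiveAffineOnPoints : (d : ℕ) → (Aut I → Set) → Set
    PrimitiveAffineOnPoints d G =
      ∃ λ (φ : Fin v → Vect d) →
          Bijective _≡_ _≋_ φ
        × (∀ g → G g → ∃ λ (A : Mat d) → Invertible A × ∃ λ (c : Vect d) →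
             ∀ α → φ (pt g α) ≋ ((A · φ α) ⊕ c))
        × (∀ (c : Vect d) → ∃ λ g → G g × (∀ α → φ (pt g α) ≋ (φ α ⊕ c)))
        × PrimitiveOn G pt allTrue

    -- D is (isomorphic to) a subdesign of AG_i(d,p): points identified
    -- with F_p^d via ψ, each block's point set is a coset w + U of an
    -- i-dimensional subspace U = span of linearly independent u_1..u_i,
    -- and distinct blocks give distinct cosets.
    SubdesignAG : (d i : ℕ) → Set
    SubdesignAG d i =
      ∃ λ (ψ : Fin v → Vect d) →
          Bijective _≡_ _≋_ ψ
        × (∀ β → ∃ λ (u : Fin i → Vect d) → LinIndep u × ∃ λ (w : Vect d) →
             ∀ α → (I α β ≡ true → ∃ λ c → ψ α ≋ (w ⊕ lincomb c u))
                 × ((∃ λ c → ψ α ≋ (w ⊕ lincomb c u)) → I α β ≡ true))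
        × (∀ β β' → (∀ α → I α β ≡ I α β') → β ≡ β')

{-# OPTIONS --safe #-}
-- Identify the points with 𝔽ₚᵈ, so that G acts by affine maps and contains the translation
-- group T.  Local primitivity at a point α makes blocks determined by their point sets (otherwise
-- every block through α would contain every point, and k = v).  If a translation mapped a block
-- through α to a different block through α, the T-orbit relation on the blocks through α would be
-- a non-discrete, hence universal, G_α-invariant equivalence, and T would be transitive on blocks.
-- A normal subgroup H moving some block contains a non-trivial translation (an element of H itself,
-- or its commutator with a translation), hence by primitivity of G on points all of T, so G would
-- be quasiprimitive on blocks.  Therefore a translation fixes every block that shares a point with
-- its image, so each block is closed under x, y, z ↦ z + (y − x): it is a coset of an 𝔽ₚ-subspace,
-- of size pⁱ with 0 < i < d because 2 ≤ k < v.  Finally a symmetric design has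
-- k(k − 1) = (v − 1)λ, and pⁱ(pⁱ − 1) = (pᵈ − 1)λ is impossible since pᵈ − 1 would divide pⁱ − 1.

module Submission where

open import Defs
open import Data.Nat using (ℕ; _<_; _≤_; NonZero)
open import Data.Nat.Primality using (Prime)
open import Data.Fin using (Fin)
open import Data.Bool using (Bool)
open import Data.Product using (∃; _×_)
open import Relation.Nullary using (¬_)
open import Relation.Binary.PropositionalEquality using (_≢_)

open import Algebra.Bundles using (AbelianGroup; CommutativeRing)
open import Algebra.Consequences.Propositional using (comm∧idˡ⇒id; comm∧invˡ⇒inv; comm∧distrʳ⇒distr)
import Algebra.Construct.Pointwise as Pointwise
import Algebra.Properties.Group as GroupProperties
import Algebra.Properties.Ring as RingProperties
open import Algebra.Structures using (IsCommutativeRing)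
open import Data.Bool as Bool using (true; false; if_then_else_; _∧_)
open import Data.Bool.Properties using (∧-idem)
open import Data.Fin as Fin using (toℕ; punchIn; finToFun; funToFin) renaming (zero to fz; suc to fs)
import Data.Fin.Properties as Fin
open import Data.Nat as ℕ using (zero; suc; z≤n; s≤s; _%_)
import Data.Nat.Properties as ℕ
open import Data.Nat.Divisibility using (_∣_; m%n≡0⇒n∣m; n∣m⇒m%n≡0; ∣m+n∣m⇒∣n; ∣⇒≤; m∣m*n)
open import Data.Nat.DivMod using (_mod_; %-distribˡ-+; %-distribˡ-*; m<n⇒m%n≡m; n%n≡0)
open import Data.Nat.Primality using (euclidsLemma; prime⇒nonTrivial)
open import Data.Nat.Solver using (module +-*-Solver)
open import Data.Empty using (⊥)
open import Data.Product using (_,_; proj₁; proj₂)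
open import Data.Sum using (_⊎_; inj₁; inj₂)
open import Data.Vec.Functional using (_∷_)
open import Effect.Monad using (RawMonad)
open import Function using (_∘_; id; _⇔_; mk⇔; Equivalence; case_of_)
open import Function.Definitions using (Injective)
open import Level using (0ℓ)
open import Relation.Binary.PropositionalEquality
  using (_≡_; refl; sym; trans; cong; cong₂; subst; subst₂; isEquivalence; module ≡-Reasoning)
open import Relation.Binary.Structures using (IsDecEquivalence)
open import Relation.Nullary using (Dec; yes; no; does; ¬?; contradiction)
open import Relation.Nullary.Decidable using (map′; _×-dec_; dec-true; does-⇔; ¬¬-excluded-middle)
open import Relation.Nullary.Negation using (¬¬-Monad)

injective⇒surjective : ∀ {n} (f : Fin n → Fin n) → Injective _≡_ _≡_ f → ∀ y → ∃ λ x → f x ≡ y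
injective⇒surjective {suc n} f f-inj y with Fin.any? (λ x → f x Fin.≟ y)
... | yes hit = hit
... | no miss = contradiction (Fin.injective⇒≤ g-inj) ℕ.1+n≰n
  where
  g : Fin (suc n) → Fin n
  g x = Fin.punchOut {i = y} (λ fx≡y → miss (x , sym fx≡y))
  g-inj : Injective _≡_ _≡_ g
  g-inj = f-inj ∘ Fin.punchOut-injective {i = y} _ _

funToFin-cong : ∀ {m n} {f g : Fin m → Fin n} → (∀ i → f i ≡ g i) → funToFin f ≡ funToFin g
funToFin-cong {zero}  f≗g = refl
funToFin-cong {suc m} f≗g = cong₂ Fin.combine (f≗g fz) (funToFin-cong (f≗g ∘ fs))

module ZMod (p : ℕ) .{{_ : NonZero p}} where

  infixl 6 _+_
  infixl 7 _*_

  _+_ _*_ : Fin p → Fin p → Fin p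
  _+_ = _+F_ p
  _*_ = _*F_ p

  0# 1# : Fin p
  0# = 0F p
  1# = 1 mod p

  -_ : Fin p → Fin p
  - a = (p ℕ.∸ toℕ a) mod p

  toℕ-mod : ∀ m → toℕ (m mod p) ≡ m % p
  toℕ-mod m = Fin.toℕ-fromℕ< _

  mod-toℕ : ∀ a → toℕ a mod p ≡ a
  mod-toℕ a = Fin.toℕ-injective (trans (toℕ-mod (toℕ a)) (m<n⇒m%n≡m (Fin.toℕ<n a)))

  mod-cong : ∀ {m n} → m % p ≡ n % p → m mod p ≡ n mod p
  mod-cong eq = Fin.toℕ-injective (trans (toℕ-mod _) (trans eq (sym (toℕ-mod _))))

  mod-+ : ∀ m n → (m mod p) + (n mod p) ≡ (m ℕ.+ n) mod p
  mod-+ m n = mod-cong (begin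
    (toℕ (m mod p) ℕ.+ toℕ (n mod p)) % p ≡⟨ cong₂ (λ x y → (x ℕ.+ y) % p) (toℕ-mod m) (toℕ-mod n) ⟩
    (m % p ℕ.+ n % p) % p                 ≡⟨ sym (%-distribˡ-+ m n p) ⟩
    (m ℕ.+ n) % p                         ∎)
    where open ≡-Reasoning

  mod-* : ∀ m n → (m mod p) * (n mod p) ≡ (m ℕ.* n) mod p
  mod-* m n = mod-cong (begin
    (toℕ (m mod p) ℕ.* toℕ (n mod p)) % p ≡⟨ cong₂ (λ x y → (x ℕ.* y) % p) (toℕ-mod m) (toℕ-mod n) ⟩
    ((m % p) ℕ.* (n % p)) % p             ≡⟨ sym (%-distribˡ-* m n p) ⟩
    (m ℕ.* n) % p                         ∎)
    where open ≡-Reasoning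

  private module Laws where

    +-assoc : ∀ a b c → (a + b) + c ≡ a + (b + c)
    +-assoc a b c = begin
      (a + b) + c                            ≡⟨ cong (a + b +_) (sym (mod-toℕ c)) ⟩
      (a + b) + (toℕ c mod p)                ≡⟨ mod-+ (toℕ a ℕ.+ toℕ b) (toℕ c) ⟩
      (toℕ a ℕ.+ toℕ b ℕ.+ toℕ c) mod p      ≡⟨ cong (_mod p) (ℕ.+-assoc (toℕ a) (toℕ b) (toℕ c)) ⟩
      (toℕ a ℕ.+ (toℕ b ℕ.+ toℕ c)) mod p    ≡⟨ sym (mod-+ (toℕ a) (toℕ b ℕ.+ toℕ c)) ⟩
      (toℕ a mod p) + (b + c)                ≡⟨ cong (_+ (b + c)) (mod-toℕ a) ⟩
      a + (b + c)                            ∎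
      where open ≡-Reasoning

    +-comm : ∀ a b → a + b ≡ b + a
    +-comm a b = cong (_mod p) (ℕ.+-comm (toℕ a) (toℕ b))

    +-identityˡ : ∀ a → 0# + a ≡ a
    +-identityˡ a = trans (cong (0# +_) (sym (mod-toℕ a))) (trans (mod-+ 0 (toℕ a)) (mod-toℕ a))

    -‿inverseˡ : ∀ a → - a + a ≡ 0#
    -‿inverseˡ a = begin
      - a + a                           ≡⟨ cong (- a +_) (sym (mod-toℕ a)) ⟩
      - a + (toℕ a mod p)               ≡⟨ mod-+ (p ℕ.∸ toℕ a) (toℕ a) ⟩
      (p ℕ.∸ toℕ a ℕ.+ toℕ a) mod p     ≡⟨ cong (_mod p) (ℕ.m∸n+n≡m (ℕ.<⇒≤ (Fin.toℕ<n a))) ⟩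
      p mod p                           ≡⟨ mod-cong (trans (n%n≡0 p) (sym (m<n⇒m%n≡m (ℕ.>-nonZero⁻¹ p)))) ⟩
      0#                                ∎
      where open ≡-Reasoning

    *-assoc : ∀ a b c → (a * b) * c ≡ a * (b * c)
    *-assoc a b c = begin
      (a * b) * c                            ≡⟨ cong (a * b *_) (sym (mod-toℕ c)) ⟩
      (a * b) * (toℕ c mod p)                ≡⟨ mod-* (toℕ a ℕ.* toℕ b) (toℕ c) ⟩
      (toℕ a ℕ.* toℕ b ℕ.* toℕ c) mod p      ≡⟨ cong (_mod p) (ℕ.*-assoc (toℕ a) (toℕ b) (toℕ c)) ⟩
      (toℕ a ℕ.* (toℕ b ℕ.* toℕ c)) mod p    ≡⟨ sym (mod-* (toℕ a) (toℕ b ℕ.* toℕ c)) ⟩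
      (toℕ a mod p) * (b * c)                ≡⟨ cong (_* (b * c)) (mod-toℕ a) ⟩
      a * (b * c)                            ∎
      where open ≡-Reasoning

    *-comm : ∀ a b → a * b ≡ b * a
    *-comm a b = cong (_mod p) (ℕ.*-comm (toℕ a) (toℕ b))

    *-identityˡ : ∀ a → 1# * a ≡ a
    *-identityˡ a = begin
      1# * a                 ≡⟨ cong (1# *_) (sym (mod-toℕ a)) ⟩
      1# * (toℕ a mod p)     ≡⟨ mod-* 1 (toℕ a) ⟩
      (1 ℕ.* toℕ a) mod p    ≡⟨ cong (_mod p) (ℕ.*-identityˡ (toℕ a)) ⟩
      toℕ a mod p            ≡⟨ mod-toℕ a ⟩
      a                      ∎
      where open ≡-Reasoning

    *-distribʳ-+ : ∀ a b c → (b + c) * a ≡ b * a + c * a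
    *-distribʳ-+ a b c = begin
      (b + c) * a                                   ≡⟨ cong ((b + c) *_) (sym (mod-toℕ a)) ⟩
      (b + c) * (toℕ a mod p)                       ≡⟨ mod-* (toℕ b ℕ.+ toℕ c) (toℕ a) ⟩
      ((toℕ b ℕ.+ toℕ c) ℕ.* toℕ a) mod p           ≡⟨ cong (_mod p) (ℕ.*-distribʳ-+ (toℕ a) (toℕ b) (toℕ c)) ⟩
      (toℕ b ℕ.* toℕ a ℕ.+ toℕ c ℕ.* toℕ a) mod p   ≡⟨ sym (mod-+ (toℕ b ℕ.* toℕ a) (toℕ c ℕ.* toℕ a)) ⟩
      b * a + c * a                                 ∎
      where open ≡-Reasoning

  isCommutativeRing : IsCommutativeRing _≡_ _+_ _*_ -_ 0# 1#
  isCommutativeRing = record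
    { isRing = record
      { +-isAbelianGroup = record
        { isGroup = record
          { isMonoid = record
            { isSemigroup = record
              { isMagma = record { isEquivalence = isEquivalence ; ∙-cong = cong₂ _+_ }
              ; assoc = Laws.+-assoc }
            ; identity = comm∧idˡ⇒id Laws.+-comm Laws.+-identityˡ }
          ; inverse = comm∧invˡ⇒inv Laws.+-comm Laws.-‿inverseˡ
          ; ⁻¹-cong = cong -_ }
        ; comm = Laws.+-comm }
      ; *-cong = cong₂ _*_
      ; *-assoc = Laws.*-assoc
      ; *-identity = comm∧idˡ⇒id Laws.*-comm Laws.*-identityˡ
      ; distrib = comm∧distrʳ⇒distr (cong₂ _+_) Laws.*-comm Laws.*-distribʳ-+ }
    ; *-comm = Laws.*-comm }

  commutativeRing : CommutativeRing 0ℓ 0ℓ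
  commutativeRing = record { isCommutativeRing = isCommutativeRing }

  open CommutativeRing commutativeRing public
    using ( ring; +-group; +-abelianGroup; +-commutativeMonoid; _-_
          ; +-assoc; +-comm; +-identityˡ; +-identityʳ; -‿inverseʳ
          ; *-assoc; *-comm; *-identityˡ; *-identityʳ; distribˡ; distribʳ; zeroˡ; zeroʳ )
  open RingProperties ring public using (x[y-z]≈xy-xz; -1*x≈-x)
  open GroupProperties +-group using (x∙y⁻¹≈ε⇒x≈y)

  mod-suc : ∀ n → suc n mod p ≡ 1# + n mod p
  mod-suc n = sym (mod-+ 1 n)

  toℕ-0# : toℕ 0# ≡ 0
  toℕ-0# = trans (toℕ-mod 0) (m<n⇒m%n≡m (ℕ.>-nonZero⁻¹ p))

  module _ (p-prime : Prime p) where

    private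
      divides⇒≡0# : ∀ a → p ∣ toℕ a → a ≡ 0#
      divides⇒≡0# a p∣a = Fin.toℕ-injective (begin
        toℕ a      ≡⟨ sym (m<n⇒m%n≡m (Fin.toℕ<n a)) ⟩
        toℕ a % p  ≡⟨ n∣m⇒m%n≡0 (toℕ a) p p∣a ⟩
        0          ≡⟨ sym toℕ-0# ⟩
        toℕ 0#     ∎)
        where open ≡-Reasoning

      ≡0#⇒divides : ∀ a b → a * b ≡ 0# → p ∣ toℕ a ℕ.* toℕ b
      ≡0#⇒divides a b ab≡0 = m%n≡0⇒n∣m _ p (trans (sym (toℕ-mod _)) (trans (cong toℕ ab≡0) toℕ-0#))

    *-integral : ∀ a b → a * b ≡ 0# → a ≡ 0# ⊎ b ≡ 0#
    *-integral a b ab≡0 with euclidsLemma (toℕ a) (toℕ b) p-prime (≡0#⇒divides a b ab≡0)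
    ... | inj₁ p∣a = inj₁ (divides⇒≡0# a p∣a)
    ... | inj₂ p∣b = inj₂ (divides⇒≡0# b p∣b)

    *-cancelˡ : ∀ {a} → a ≢ 0# → ∀ {x y} → a * x ≡ a * y → x ≡ y
    *-cancelˡ {a} a≢0 {x} {y} ax≡ay with *-integral a (x - y) a[x-y]≡0
      where
      a[x-y]≡0 = trans (x[y-z]≈xy-xz a x y) (trans (cong (_- a * y) ax≡ay) (-‿inverseʳ (a * y)))
    ... | inj₁ a≡0   = contradiction a≡0 a≢0
    ... | inj₂ x-y≡0 = x∙y⁻¹≈ε⇒x≈y x y x-y≡0

    ∃-*-inverse : ∀ {a} → a ≢ 0# → ∃ λ b → a * b ≡ 1#
    ∃-*-inverse a≢0 = injective⇒surjective _ (*-cancelˡ a≢0) 1#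

module AbelianGroupIdentities {a ℓ} (A : AbelianGroup a ℓ) where

  open AbelianGroup A renaming (trans to ≈-trans)
  open import Algebra.Properties.AbelianGroup A public using (x∙y⁻¹≈ε⇒x≈y; ⁻¹-anti-homo‿-; ∙-cancelˡ)
  open import Algebra.Properties.CommutativeSemigroup commutativeSemigroup public using (xy∙z≈xz∙y)
  open import Relation.Binary.Reasoning.Setoid setoid

  x∙[y-x]≈y : ∀ x y → x ∙ (y - x) ≈ y
  x∙[y-x]≈y x y = begin
    x ∙ (y ∙ x ⁻¹)  ≈⟨ ∙-congˡ (comm y (x ⁻¹)) ⟩
    x ∙ (x ⁻¹ ∙ y)  ≈⟨ assoc x (x ⁻¹) y ⟨
    x ∙ x ⁻¹ ∙ y    ≈⟨ ∙-congʳ (inverseʳ x) ⟩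
    ε ∙ y           ≈⟨ identityˡ y ⟩
    y               ∎

  [x∙y]-y≈x : ∀ x y → x ∙ y - y ≈ x
  [x∙y]-y≈x x y = begin
    x ∙ y ∙ y ⁻¹    ≈⟨ assoc x y (y ⁻¹) ⟩
    x ∙ (y ∙ y ⁻¹)  ≈⟨ ∙-congˡ (inverseʳ y) ⟩
    x ∙ ε           ≈⟨ identityʳ x ⟩
    x               ∎

  x≈y∙z⇒x-y≈z : ∀ {x y z} → x ≈ y ∙ z → x - y ≈ z
  x≈y∙z⇒x-y≈z {x} {y} {z} x≈yz = begin
    x ∙ y ⁻¹      ≈⟨ ∙-congʳ (≈-trans x≈yz (comm y z)) ⟩
    z ∙ y ∙ y ⁻¹  ≈⟨ [x∙y]-y≈x z y ⟩
    z             ∎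

  [y-x]∙[z-y]≈z-x : ∀ x y z → (y - x) ∙ (z - y) ≈ z - x
  [y-x]∙[z-y]≈z-x x y z = begin
    (y ∙ x ⁻¹) ∙ (z ∙ y ⁻¹)  ≈⟨ comm (y ∙ x ⁻¹) (z ∙ y ⁻¹) ⟩
    (z ∙ y ⁻¹) ∙ (y ∙ x ⁻¹)  ≈⟨ assoc z (y ⁻¹) (y ∙ x ⁻¹) ⟩
    z ∙ (y ⁻¹ ∙ (y ∙ x ⁻¹))  ≈⟨ ∙-congˡ (assoc (y ⁻¹) y (x ⁻¹)) ⟨
    z ∙ (y ⁻¹ ∙ y ∙ x ⁻¹)    ≈⟨ ∙-congˡ (∙-congʳ (inverseˡ y)) ⟩
    z ∙ (ε ∙ x ⁻¹)           ≈⟨ ∙-congˡ (identityˡ (x ⁻¹)) ⟩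
    z ∙ x ⁻¹                 ∎

  [x∙y]∙[z-y]≈x∙z : ∀ x y z → (x ∙ y) ∙ (z - y) ≈ x ∙ z
  [x∙y]∙[z-y]≈x∙z x y z = begin
    (x ∙ y) ∙ (z - y)  ≈⟨ assoc x y (z - y) ⟩
    x ∙ (y ∙ (z - y))  ≈⟨ ∙-congˡ (x∙[y-x]≈y y z) ⟩
    x ∙ z              ∎

  x-ε≈x : ∀ x → x - ε ≈ x
  x-ε≈x x = ≈-trans (∙-congˡ ε⁻¹≈ε) (identityʳ x)
    where open import Algebra.Properties.Group group using (ε⁻¹≈ε)

module Vectors (p : ℕ) .{{_ : NonZero p}} where

  open ZMod p

  infix  4 _≈_
  infixl 6 _+ᵥ_
  infixl 7 _*ᵥ_
  infixr 7 _·ᴹ_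

  _≈_ : ∀ {d} → Vect p d → Vect p d → Set
  _≈_ = _≋_ p

  _+ᵥ_ : ∀ {d} → Vect p d → Vect p d → Vect p d
  _+ᵥ_ = _⊕_ p

  0ᵥ : ∀ {d} → Vect p d
  0ᵥ = 0V p

  _*ᵥ_ : ∀ {d} → Fin p → Vect p d → Vect p d
  (a *ᵥ x) j = a * x j

  _·ᴹ_ : ∀ {d} → Mat p d → Vect p d → Vect p d
  _·ᴹ_ = _·_ p

  open import Algebra.Properties.CommutativeMonoid.Sum +-commutativeMonoid
    using (sum; sum-cong-≗; ∑-distrib-+; sum-replicate-zero)

  vectorGroup : ℕ → AbelianGroup 0ℓ 0ℓ
  vectorGroup d = Pointwise.abelianGroup (Fin d) +-abelianGroup

  module _ {d : ℕ} where

    open AbelianGroup (vectorGroup d) public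
      using (setoid; ∙-cong; comm; assoc; identityʳ; inverseʳ)
      renaming (⁻¹-cong to -ᵥ-cong; refl to ≈-refl; sym to ≈-sym; trans to ≈-trans; _⁻¹ to infix 8 -ᵥ_; _-_ to infixl 6 _-ᵥ_)
    open AbelianGroupIdentities (vectorGroup d) public

    infix 4 _≈?_
    _≈?_ : (x y : Vect p d) → Dec (x ≈ y)
    x ≈? y = Fin.all? (λ j → x j Fin.≟ y j)

    -1*[y-x]≈x-y : (x y : Vect p d) → - 1# *ᵥ (y -ᵥ x) ≈ x -ᵥ y
    -1*[y-x]≈x-y x y = ≈-trans (λ j → -1*x≈-x (y j - x j)) (⁻¹-anti-homo‿- y x)

  private
    sumF≡sum : ∀ {n} (f : Fin n → Fin p) → sumF p f ≡ sum f
    sumF≡sum {zero}  f = refl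
    sumF≡sum {suc n} f = cong (f fz +_) (sumF≡sum (f ∘ fs))

  sumF-cong : ∀ {n} {f g : Fin n → Fin p} → (∀ l → f l ≡ g l) → sumF p f ≡ sumF p g
  sumF-cong {f = f} {g} f≗g = trans (sumF≡sum f) (trans (sum-cong-≗ f≗g) (sym (sumF≡sum g)))

  sumF-+ : ∀ {n} (f g : Fin n → Fin p) → sumF p (λ l → f l + g l) ≡ sumF p f + sumF p g
  sumF-+ f g = trans (sumF≡sum (λ l → f l + g l)) (trans (∑-distrib-+ f g) (sym (cong₂ _+_ (sumF≡sum f) (sumF≡sum g))))

  sumF-0 : ∀ {n} → sumF p {n} (λ _ → 0#) ≡ 0#
  sumF-0 {n} = trans (sumF≡sum {n} (λ _ → 0#)) (sum-replicate-zero n)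

  module _ {d : ℕ} where

    ·-cong : (A : Mat p d) {x y : Vect p d} → x ≈ y → A ·ᴹ x ≈ A ·ᴹ y
    ·-cong A x≈y j = sumF-cong (λ l → cong (A j l *_) (x≈y l))

    ·-+ᵥ : (A : Mat p d) (x y : Vect p d) → A ·ᴹ (x +ᵥ y) ≈ A ·ᴹ x +ᵥ A ·ᴹ y
    ·-+ᵥ A x y j = trans (sumF-cong (λ l → distribˡ (A j l) (x l) (y l))) (sumF-+ (λ l → A j l * x l) (λ l → A j l * y l))

    ·-0ᵥ : (A : Mat p d) → A ·ᴹ 0ᵥ ≈ 0ᵥ
    ·-0ᵥ A j = trans (sumF-cong (λ l → zeroʳ (A j l))) (sumF-0 {d})

  module _ {d i : ℕ} where

    lincomb-cong : {c c′ : Vect p i} (u : Fin i → Vect p d) → c ≈ c′ → lincomb p c u ≈ lincomb p c′ u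
    lincomb-cong u c≈c′ j = sumF-cong (λ l → cong (_* u l j) (c≈c′ l))

    lincomb-+ᵥ : (c c′ : Vect p i) (u : Fin i → Vect p d) → lincomb p (c +ᵥ c′) u ≈ lincomb p c u +ᵥ lincomb p c′ u
    lincomb-+ᵥ c c′ u j = trans (sumF-cong (λ l → distribʳ (u l j) (c l) (c′ l))) (sumF-+ (λ l → c l * u l j) (λ l → c′ l * u l j))

    lincomb-0ᵥ : (u : Fin i → Vect p d) → lincomb p 0ᵥ u ≈ 0ᵥ
    lincomb-0ᵥ u j = trans (sumF-cong (λ l → zeroˡ (u l j))) (sumF-0 {i})

    lincomb-injective : {u : Fin i → Vect p d} → LinIndep p u →
                        ∀ {c c′} → lincomb p c u ≈ lincomb p c′ u → c ≈ c′
    lincomb-injective {u} indep {c} {c′} eq = x∙y⁻¹≈ε⇒x≈y c c′ (indep (c -ᵥ c′) lincomb[c-c′]≈0)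
      where
      lincomb[c-c′]≈0 : lincomb p (c -ᵥ c′) u ≈ 0ᵥ
      lincomb[c-c′]≈0 = ≈-sym (∙-cancelˡ (lincomb p c′ u) _ _ (begin
        lincomb p c′ u +ᵥ 0ᵥ                     ≈⟨ identityʳ _ ⟩
        lincomb p c′ u                           ≈⟨ eq ⟨
        lincomb p c u                            ≈⟨ lincomb-cong u (x∙[y-x]≈y c′ c) ⟨
        lincomb p (c′ +ᵥ (c -ᵥ c′)) u            ≈⟨ lincomb-+ᵥ c′ (c -ᵥ c′) u ⟩
        lincomb p c′ u +ᵥ lincomb p (c -ᵥ c′) u  ∎))
        where open import Relation.Binary.Reasoning.Setoid setoid

  -- Over ℤ/p every scalar is a sum of ones, so additive subgroups are subspaces.
  record IsSubspace {d} (P : Vect p d → Set) : Set where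
    field
      ∈-resp : ∀ {x y} → x ≈ y → P x → P y
      0∈     : P 0ᵥ
      +∈     : ∀ {x y} → P x → P y → P (x +ᵥ y)

    *∈ : ∀ a {x} → P x → P (a *ᵥ x)
    *∈ a {x} Px = ∈-resp (λ j → cong (_* x j) (mod-toℕ a)) (multiple∈ (toℕ a))
      where
      multiple∈ : ∀ n → P ((n mod p) *ᵥ x)
      multiple∈ zero    = ∈-resp (λ j → sym (zeroˡ (x j))) 0∈
      multiple∈ (suc n) = ∈-resp (λ j → sym ([1+n]a≡a+na n (x j))) (+∈ Px (multiple∈ n))
        where
        open ≡-Reasoning
        [1+n]a≡a+na : ∀ n a → (suc n mod p) * a ≡ a + (n mod p) * a
        [1+n]a≡a+na n a = begin
          (suc n mod p) * a       ≡⟨ cong (_* a) (mod-suc n) ⟩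
          (1# + n mod p) * a      ≡⟨ distribʳ a 1# (n mod p) ⟩
          1# * a + (n mod p) * a  ≡⟨ cong (_+ (n mod p) * a) (*-identityˡ a) ⟩
          a + (n mod p) * a       ∎

    lincomb∈ : ∀ {i} (u : Fin i → Vect p d) → (∀ l → P (u l)) → ∀ c → P (lincomb p c u)
    lincomb∈ {zero}  u Pu c = 0∈
    lincomb∈ {suc i} u Pu c = +∈ (*∈ (c fz) (Pu fz)) (lincomb∈ (u ∘ fs) (Pu ∘ fs) (c ∘ fs))

  search : ∀ {i} {Q : Vect p i → Set} → (∀ {c c′} → c ≈ c′ → Q c → Q c′) →
           (∀ c → Dec (Q c)) → Dec (∃ Q)
  search resp Q? = map′ (λ (n , q) → finToFun n , q)
                        (λ (c , q) → funToFin c , resp (≈-sym (Fin.finToFun-funToFin c)) q)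
                        (Fin.any? (Q? ∘ finToFun))

  module _ {d i : ℕ} (u : Fin i → Vect p d) where

    Span : Vect p d → Set
    Span x = ∃ λ c → x ≈ lincomb p c u

    span-isSubspace : IsSubspace Span
    span-isSubspace = record
      { ∈-resp = λ { x≈y (c , x≈) → c , ≈-trans (≈-sym x≈y) x≈ }
      ; 0∈     = 0ᵥ , ≈-sym (lincomb-0ᵥ u)
      ; +∈     = λ { (c , x≈) (c′ , y≈) → c +ᵥ c′ , ≈-trans (∙-cong x≈ y≈) (≈-sym (lincomb-+ᵥ c c′ u)) }
      }

    span? : ∀ x → Dec (Span x)
    span? x = search (λ c≈c′ x≈ → ≈-trans x≈ (lincomb-cong u c≈c′)) (λ c → x ≈? lincomb p c u)

    span-minimal : ∀ {P} → IsSubspace P → (∀ l → P (u l)) → ∀ {x} → Span x → P x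
    span-minimal P-sub u∈P (c , x≈) = ∈-resp (≈-sym x≈) (lincomb∈ u u∈P c)
      where open IsSubspace P-sub

  generator∈span : ∀ {d i} (u : Fin i → Vect p d) l → Span u (u l)
  generator∈span {i = suc i} u fz = 1# ∷ 0ᵥ , λ j → sym (begin
    1# * u fz j + lincomb p 0ᵥ (u ∘ fs) j  ≡⟨ cong₂ _+_ (*-identityˡ (u fz j)) (lincomb-0ᵥ (u ∘ fs) j) ⟩
    u fz j + 0#                           ≡⟨ +-identityʳ (u fz j) ⟩
    u fz j                                ∎)
    where open ≡-Reasoning
  generator∈span {i = suc i} u (fs l) with c , eq ← generator∈span (u ∘ fs) l =
    0# ∷ c , λ j → trans (eq j) (sym (trans (cong (_+ lincomb p c (u ∘ fs) j) (zeroˡ (u fz j))) (+-identityˡ _)))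

  record Basis {d} (P : Vect p d → Set) : Set where
    field
      dim         : ℕ
      vector      : Fin dim → Vect p d
      independent : LinIndep p vector
      vector∈     : ∀ l → P (vector l)
      spans       : ∀ {x} → P x → Span vector x

  module _ {d : ℕ} where

    0∷-cong : {x y : Vect p d} → x ≈ y → 0# ∷ x ≈ 0# ∷ y
    0∷-cong x≈y fz     = refl
    0∷-cong x≈y (fs j) = x≈y j

    ≈0∷tail : (x : Vect p (suc d)) → x fz ≡ 0# → x ≈ 0# ∷ (x ∘ fs)
    ≈0∷tail x x₀≡0 fz     = x₀≡0
    ≈0∷tail x x₀≡0 (fs j) = refl

    lincomb-0∷ : ∀ {i} (c : Vect p i) (u : Fin i → Vect p d) →
                 lincomb p c (λ l → 0# ∷ u l) ≈ 0# ∷ lincomb p c u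
    lincomb-0∷ {i} c u fz = trans (sumF-cong (λ l → zeroʳ (c l))) (sumF-0 {i})
    lincomb-0∷ c u (fs j) = refl

    0∷-isSubspace : {P : Vect p (suc d) → Set} → IsSubspace P → IsSubspace (λ y → P (0# ∷ y))
    0∷-isSubspace P-sub = record
      { ∈-resp = ∈-resp ∘ 0∷-cong
      ; 0∈     = ∈-resp (≈0∷tail 0ᵥ refl) 0∈
      ; +∈     = λ Px Py → ∈-resp (≈0∷tail _ (+-identityʳ 0#)) (+∈ Px Py)
      }
      where open IsSubspace P-sub

  module _ {d : ℕ} {P : Vect p (suc d) → Set} (P-sub : IsSubspace P) (B : Basis (λ y → P (0# ∷ y))) where

    open IsSubspace P-sub
    open Basis B

    basis-without-pivot : (∀ {x} → P x → x fz ≡ 0#) → Basis P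
    basis-without-pivot x₀≡0 = record
      { dim         = dim
      ; vector      = λ l → 0# ∷ vector l
      ; independent = λ c c≈0 → independent c (λ j → trans (lincomb-0∷ c vector (fs j)) (c≈0 (fs j)))
      ; vector∈     = vector∈
      ; spans       = λ {x} Px → let (c , tail≈) = spans (∈-resp (≈0∷tail x (x₀≡0 Px)) Px) in
                        c , ≈-trans (≈0∷tail x (x₀≡0 Px)) (≈-trans (0∷-cong tail≈) (≈-sym (lincomb-0∷ c vector)))
      }

    basis-with-pivot : Prime p → (z : Vect p (suc d)) → P z → z fz ≢ 0# → Basis P
    basis-with-pivot p-prime z Pz z₀≢0 = record
      { dim         = suc dim
      ; vector      = z ∷ (λ l → 0# ∷ vector l)
      ; independent = independent′
      ; vector∈     = λ { fz → Pz ; (fs l) → vector∈ l }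
      ; spans       = spans′
      }
      where
      independent′ : LinIndep p (z ∷ (λ l → 0# ∷ vector l))
      independent′ c c≈0 = λ { fz → c₀≡0 ; (fs l) → independent (c ∘ fs) tail≈0 l }
        where
        open ≡-Reasoning
        c₀z₀≡0 : c fz * z fz ≡ 0#
        c₀z₀≡0 = begin
          c fz * z fz                                             ≡⟨ +-identityʳ _ ⟨
          c fz * z fz + 0#                                        ≡⟨ cong (c fz * z fz +_) (lincomb-0∷ (c ∘ fs) vector fz) ⟨
          c fz * z fz + lincomb p (c ∘ fs) (λ l → 0# ∷ vector l) fz ≡⟨ c≈0 fz ⟩
          0#                                                      ∎
        c₀≡0 : c fz ≡ 0#
        c₀≡0 with *-integral p-prime (c fz) (z fz) c₀z₀≡0
        ... | inj₁ c₀≡0 = c₀≡0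
        ... | inj₂ z₀≡0 = contradiction z₀≡0 z₀≢0
        tail≈0 : lincomb p (c ∘ fs) vector ≈ 0ᵥ
        tail≈0 j = begin
          lincomb p (c ∘ fs) vector j                    ≡⟨ +-identityˡ _ ⟨
          0# + lincomb p (c ∘ fs) vector j               ≡⟨ cong (_+ lincomb p (c ∘ fs) vector j) (zeroˡ (z (fs j))) ⟨
          0# * z (fs j) + lincomb p (c ∘ fs) vector j    ≡⟨ cong (λ c₀ → c₀ * z (fs j) + lincomb p (c ∘ fs) vector j) c₀≡0 ⟨
          c fz * z (fs j) + lincomb p (c ∘ fs) vector j  ≡⟨ c≈0 (fs j) ⟩
          0#                                             ∎

      spans′ : ∀ {x} → P x → Span (z ∷ (λ l → 0# ∷ vector l)) x
      spans′ {x} Px = a ∷ c , (begin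
        x                                         ≈⟨ x∙[y-x]≈y (a *ᵥ z) x ⟨
        a *ᵥ z +ᵥ y                               ≈⟨ ∙-cong ≈-refl (≈0∷tail y y₀≡0) ⟩
        a *ᵥ z +ᵥ (0# ∷ (y ∘ fs))                 ≈⟨ ∙-cong ≈-refl (0∷-cong tail≈) ⟩
        a *ᵥ z +ᵥ (0# ∷ lincomb p c vector)       ≈⟨ ∙-cong ≈-refl (lincomb-0∷ c vector) ⟨
        a *ᵥ z +ᵥ lincomb p c (λ l → 0# ∷ vector l) ∎)
        where
        open import Relation.Binary.Reasoning.Setoid setoid
        z₀⁻¹ = proj₁ (∃-*-inverse p-prime z₀≢0)
        a = x fz * z₀⁻¹
        az₀≡x₀ : a * z fz ≡ x fz
        az₀≡x₀ = ≡.begin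
          x fz * z₀⁻¹ * z fz    ≡.≡⟨ *-assoc (x fz) z₀⁻¹ (z fz) ⟩
          x fz * (z₀⁻¹ * z fz)  ≡.≡⟨ cong (x fz *_) (trans (*-comm z₀⁻¹ (z fz)) (proj₂ (∃-*-inverse p-prime z₀≢0))) ⟩
          x fz * 1#             ≡.≡⟨ *-identityʳ (x fz) ⟩
          x fz                  ≡.∎
          where module ≡ = ≡-Reasoning
        y = x -ᵥ a *ᵥ z
        y₀≡0 : y fz ≡ 0#
        y₀≡0 = trans (cong (λ t → x fz + - t) az₀≡x₀) (-‿inverseʳ (x fz))
        Py : P y
        Py = ∈-resp (∙-cong ≈-refl (λ j → -1*x≈-x (a * z j))) (+∈ Px (*∈ (- 1#) (*∈ a Pz)))
        c = proj₁ (spans (∈-resp (≈0∷tail y y₀≡0) Py))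
        tail≈ = proj₂ (spans (∈-resp (≈0∷tail y y₀≡0) Py))

  basis : Prime p → ∀ {d} {P : Vect p d → Set} → IsSubspace P → (∀ x → Dec (P x)) → Basis P
  basis p-prime {zero} _ _ = record
    { dim = 0 ; vector = λ () ; independent = λ _ _ () ; vector∈ = λ () ; spans = λ _ → (λ ()) , (λ ()) }
  basis p-prime {suc d} {P} P-sub P? with search pivot-resp (λ z → P? z ×-dec ¬? (z fz Fin.≟ 0#))
    where
    pivot-resp : ∀ {z z′} → z ≈ z′ → P z × z fz ≢ 0# → P z′ × z′ fz ≢ 0#
    pivot-resp z≈z′ (Pz , z₀≢0) = IsSubspace.∈-resp P-sub z≈z′ Pz , z₀≢0 ∘ trans (z≈z′ fz)
  ... | yes (z , Pz , z₀≢0) = basis-with-pivot P-sub B′ p-prime z Pz z₀≢0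
    where B′ = basis p-prime (0∷-isSubspace P-sub) (P? ∘ (0# ∷_))
  ... | no no-pivot = basis-without-pivot P-sub B′ x₀≡0
    where
    B′ = basis p-prime (0∷-isSubspace P-sub) (P? ∘ (0# ∷_))
    x₀≡0 : ∀ {x} → P x → x fz ≡ 0#
    x₀≡0 {x} Px with x fz Fin.≟ 0#
    ... | yes x₀≡0 = x₀≡0
    ... | no x₀≢0  = contradiction (x , Px , x₀≢0) no-pivot

module Counting where

  open import Data.Nat using (_+_; _*_; _∸_; _^_)
  open import Algebra.Properties.CommutativeMonoid.Sum ℕ.+-0-commutativeMonoid
    using (sum; sum-cong-≗; ∑-comm; sum-remove)

  record Enumeration {n} (f : Fin n → Bool) (m : ℕ) : Set where
    field
      elem           : Fin m → Fin n
      elem-injective : Injective _≡_ _≡_ elem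
      elem-true      : ∀ j → f (elem j) ≡ true
      elem-complete  : ∀ x → f x ≡ true → ∃ λ j → elem j ≡ x

  enumerate : ∀ {n} (f : Fin n → Bool) → Enumeration f (count f)
  enumerate {zero}  f = record
    { elem = λ () ; elem-injective = λ {} ; elem-true = λ () ; elem-complete = λ () }
  enumerate {suc n} f = extend (f fz) refl
    where
    open Enumeration (enumerate (f ∘ fs))
    extend : ∀ b → f fz ≡ b → Enumeration f ((if b then 1 else 0) + count (f ∘ fs))
    extend true f₀≡true = record
      { elem           = fz ∷ (fs ∘ elem)
      ; elem-injective = λ { {fz} {fz} _ → refl ; {fs i} {fs j} eq → cong fs (elem-injective (Fin.suc-injective eq)) }
      ; elem-true      = λ { fz → f₀≡true ; (fs j) → elem-true j }
      ; elem-complete  = λ where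
          fz _           → fz , refl
          (fs x) fx      → let (j , eq) = elem-complete x fx in fs j , cong fs eq
      }
    extend false f₀≡false = record
      { elem           = fs ∘ elem
      ; elem-injective = elem-injective ∘ Fin.suc-injective
      ; elem-true      = elem-true
      ; elem-complete  = λ where
          fz f₀≡true     → contradiction (trans (sym f₀≡false) f₀≡true) λ ()
          (fs x) fx      → let (j , eq) = elem-complete x fx in j , cong fs eq
      }

  module _ {n} (f : Fin n → Bool) where

    open Enumeration (enumerate f)

    ≤count : ∀ {m} (F : Fin m → Fin n) → Injective _≡_ _≡_ F → (∀ j → f (F j) ≡ true) → m ≤ count f
    ≤count F F-injective F-true = Fin.injective⇒≤ {f = index} λ {i} {j} eq → F-injective (begin
      F i                ≡⟨ proj₂ (elem-complete (F i) (F-true i)) ⟨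
      elem (index i)     ≡⟨ cong elem eq ⟩
      elem (index j)     ≡⟨ proj₂ (elem-complete (F j) (F-true j)) ⟩
      F j                ∎)
      where
      open ≡-Reasoning
      index : ∀ j → Fin (count f)
      index j = proj₁ (elem-complete (F j) (F-true j))

    count≤ : ∀ {m} (F : Fin m → Fin n) → (∀ x → f x ≡ true → ∃ λ j → F j ≡ x) → count f ≤ m
    count≤ F F-complete = Fin.injective⇒≤ {f = index} λ {i} {j} eq → elem-injective (begin
      elem i             ≡⟨ proj₂ (F-complete (elem i) (elem-true i)) ⟨
      F (index i)        ≡⟨ cong F eq ⟩
      F (index j)        ≡⟨ proj₂ (F-complete (elem j) (elem-true j)) ⟩
      elem j             ∎)
      where
      open ≡-Reasoning
      index : ∀ j → Fin _
      index j = proj₁ (F-complete (elem j) (elem-true j))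

    count-bijection : ∀ {m} (F : Fin m → Fin n) → Injective _≡_ _≡_ F → (∀ j → f (F j) ≡ true) →
                      (∀ x → f x ≡ true → ∃ λ j → F j ≡ x) → count f ≡ m
    count-bijection F F-injective F-true F-complete = ℕ.≤-antisym (count≤ F F-complete) (≤count F F-injective F-true)

    count-all : (∀ x → f x ≡ true) → count f ≡ n
    count-all f≡true = count-bijection id id f≡true (λ x _ → x , refl)

    count-witness : 1 ≤ count f → ∃ λ x → f x ≡ true
    count-witness 1≤count = elem (Fin.fromℕ< 1≤count) , elem-true _

    two≤count : ∀ {x y} → f x ≡ true → f y ≡ true → x ≢ y → 2 ≤ count f
    two≤count {x} {y} fx fy x≢y = ≤count (x ∷ λ _ → y) injective λ { fz → fx ; (fs _) → fy }
      where
      injective : Injective _≡_ _≡_ (x ∷ λ _ → y)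
      injective {fz}    {fz}    _  = refl
      injective {fz}    {fs fz} eq = contradiction eq x≢y
      injective {fs fz} {fz}    eq = contradiction (sym eq) x≢y
      injective {fs fz} {fs fz} _  = refl

  indicator : Bool → ℕ → ℕ
  indicator b c = if b then c else 0

  count≡sum : ∀ {n} (f : Fin n → Bool) → count f ≡ sum (λ x → indicator (f x) 1)
  count≡sum {zero}  f = refl
  count≡sum {suc n} f = cong (indicator (f fz) 1 +_) (count≡sum (f ∘ fs))

  count-cong : ∀ {n} {f g : Fin n → Bool} → (∀ x → f x ≡ g x) → count f ≡ count g
  count-cong {f = f} {g} f≗g = trans (count≡sum f) (trans (sum-cong-≗ (λ x → cong (λ b → indicator b 1) (f≗g x))) (sym (count≡sum g)))

  sum-indicator : ∀ {n} (f : Fin n → Bool) c → sum (λ x → indicator (f x) c) ≡ count f * c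
  sum-indicator {zero}  f c = refl
  sum-indicator {suc n} f c with f fz
  ... | true  = cong (c +_) (sum-indicator (f ∘ fs) c)
  ... | false = sum-indicator (f ∘ fs) c

  sum-const : ∀ n c → sum {n} (λ _ → c) ≡ n * c
  sum-const zero    c = refl
  sum-const (suc n) c = cong (c +_) (sum-const n c)

  sum-const-except : ∀ {n} (t : Fin n → ℕ) α {c} → (∀ x → x ≢ α → t x ≡ c) → sum t ≡ t α + (n ∸ 1) * c
  sum-const-except {suc n} t α {c} t≡c = begin
    sum t                          ≡⟨ sum-remove t ⟩
    t α + sum (t ∘ punchIn α)      ≡⟨ cong (t α +_) (sum-cong-≗ (λ j → t≡c (punchIn α j) (Fin.punchInᵢ≢i α j))) ⟩
    t α + sum {n} (λ _ → c)        ≡⟨ cong (t α +_) (sum-const n c) ⟩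
    t α + n * c                    ∎
    where open ≡-Reasoning

  -- (1 + K) q = 1 + D turns (1 + K) K = D λ into D K + K = D q λ, so D ∣ K.
  private
    no-divisor : ∀ K D q lam → suc K * q ≡ suc D → suc K * K ≡ D * lam → 1 ≤ K → K < D → ⊥
    no-divisor K D q lam [1+K]q≡1+D [1+K]K≡Dλ 1≤K K<D =
      ℕ.<-irrefl refl (ℕ.<-≤-trans K<D (∣⇒≤ {{ℕ.>-nonZero 1≤K}} D∣K))
      where
      open +-*-Solver
      DK+K≡D[qλ] : D * K + K ≡ D * (q * lam)
      DK+K≡D[qλ] = begin
        D * K + K          ≡⟨ solve 2 (λ D K → D :* K :+ K := (con 1 :+ D) :* K) refl D K ⟩
        suc D * K          ≡⟨ cong (_* K) (sym [1+K]q≡1+D) ⟩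
        suc K * q * K      ≡⟨ solve 2 (λ K q → (con 1 :+ K) :* q :* K := q :* ((con 1 :+ K) :* K)) refl K q ⟩
        q * (suc K * K)    ≡⟨ cong (q *_) [1+K]K≡Dλ ⟩
        q * (D * lam)      ≡⟨ solve 3 (λ q D l → q :* (D :* l) := D :* (q :* l)) refl q D lam ⟩
        D * (q * lam)      ∎
        where open ≡-Reasoning
      D∣K : D ∣ K
      D∣K = ∣m+n∣m⇒∣n (subst (D ∣_) (sym DK+K≡D[qλ]) (m∣m*n (q * lam))) (m∣m*n K)

  p^i[p^i∸1]≢[p^d∸1]λ : ∀ {p i d} lam → 1 < p → 1 ≤ i → i < d → p ^ i * (p ^ i ∸ 1) ≢ (p ^ d ∸ 1) * lam
  p^i[p^i∸1]≢[p^d∸1]λ {p} {i} {d} lam 1<p 1≤i i<d eq =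
    no-divisor (p ^ i ∸ 1) (p ^ d ∸ 1) (p ^ (d ∸ i)) lam [1+K]q≡1+D [1+K]K≡Dλ 1≤K K<D
    where
    instance _ = ℕ.>-nonZero (ℕ.<-trans (s≤s z≤n) 1<p)
    1+[p^n∸1]≡p^n : ∀ n → suc (p ^ n ∸ 1) ≡ p ^ n
    1+[p^n∸1]≡p^n n = ℕ.m+[n∸m]≡n (ℕ.m^n>0 p n)
    [1+K]q≡1+D : suc (p ^ i ∸ 1) * p ^ (d ∸ i) ≡ suc (p ^ d ∸ 1)
    [1+K]q≡1+D = begin
      suc (p ^ i ∸ 1) * p ^ (d ∸ i)  ≡⟨ cong (_* p ^ (d ∸ i)) (1+[p^n∸1]≡p^n i) ⟩
      p ^ i * p ^ (d ∸ i)            ≡⟨ ℕ.^-distribˡ-+-* p i (d ∸ i) ⟨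
      p ^ (i + (d ∸ i))              ≡⟨ cong (p ^_) (ℕ.m+[n∸m]≡n (ℕ.<⇒≤ i<d)) ⟩
      p ^ d                          ≡⟨ 1+[p^n∸1]≡p^n d ⟨
      suc (p ^ d ∸ 1)                ∎
      where open ≡-Reasoning
    [1+K]K≡Dλ : suc (p ^ i ∸ 1) * (p ^ i ∸ 1) ≡ (p ^ d ∸ 1) * lam
    [1+K]K≡Dλ = trans (cong (_* (p ^ i ∸ 1)) (1+[p^n∸1]≡p^n i)) eq
    1≤K : 1 ≤ p ^ i ∸ 1
    1≤K = ℕ.∸-monoˡ-≤ 1 (ℕ.≤-trans 1<p (subst (_≤ p ^ i) (ℕ.^-identityʳ p) (ℕ.^-monoʳ-≤ p 1≤i)))
    K<D : p ^ i ∸ 1 < p ^ d ∸ 1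
    K<D = ℕ.∸-monoˡ-< (ℕ.^-monoʳ-< p 1<p i<d) (ℕ.m^n>0 p i)

  module _ {p : ℕ} (1<p : 1 < p) where

    private instance
      p≢0 : NonZero p
      p≢0 = ℕ.>-nonZero (ℕ.<-trans (s≤s z≤n) 1<p)

    ^-reflects-< : ∀ {m n} → p ^ m < p ^ n → m < n
    ^-reflects-< p^m<p^n = ℕ.≰⇒> λ n≤m → ℕ.<-irrefl refl (ℕ.<-≤-trans p^m<p^n (ℕ.^-monoʳ-≤ p n≤m))

    ^-injective : ∀ {m n} → p ^ m ≡ p ^ n → m ≡ n
    ^-injective {m} {n} p^m≡p^n = ℕ.≤-antisym
      (ℕ.≮⇒≥ λ n<m → ℕ.<-irrefl (sym p^m≡p^n) (ℕ.^-monoʳ-< p 1<p n<m))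
      (ℕ.≮⇒≥ λ m<n → ℕ.<-irrefl p^m≡p^n (ℕ.^-monoʳ-< p 1<p m<n))

open Counting

does⇒witness : ∀ {A : Set} (a? : Dec A) → does a? ≡ true → A
does⇒witness (yes a) _ = a

module _ {A X : Set} {H : A → Set} {act : A → X → X} {S : X → Bool} (H-primitive : PrimitiveOn H act S)
         {_∼_ : X → X → Set} (∼-isDecEquivalence : IsDecEquivalence _∼_)
         (∼-invariant : ∀ h x y → H h → x ∼ y ⇔ act h x ∼ act h y) where

  open IsDecEquivalence ∼-isDecEquivalence using (_≟_) renaming (refl to ∼-refl; sym to ∼-sym; trans to ∼-trans)

  primitive-dichotomy : (∀ {x y} → S x ≡ true → S y ≡ true → x ∼ y → x ≡ y)
                      ⊎ (∀ {x y} → S x ≡ true → S y ≡ true → x ∼ y)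
  primitive-dichotomy with proj₂ H-primitive (λ x y → does (x ≟ y)) invariantEquiv
    where
    invariantEquiv : InvariantEquiv H act S (λ x y → does (x ≟ y))
    invariantEquiv = (λ x _ → dec-true (x ≟ x) ∼-refl)
                   , (λ x y _ _ x∼y → dec-true (y ≟ x) (∼-sym (does⇒witness (x ≟ y) x∼y)))
                   , (λ x y z _ _ _ x∼y y∼z → dec-true (x ≟ z) (∼-trans (does⇒witness (x ≟ y) x∼y) (does⇒witness (y ≟ z) y∼z)))
                   , (λ h x y Hh _ _ → does-⇔ (∼-invariant h x y Hh) (x ≟ y) (act h x ≟ act h y))
  ... | inj₁ discrete  = inj₁ λ {x} {y} Sx Sy x∼y → discrete x y Sx Sy (dec-true (x ≟ y) x∼y)
  ... | inj₂ universal = inj₂ λ {x} {y} Sx Sy → does⇒witness (x ≟ y) (universal x y Sx Sy)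

module Incidence {v b : ℕ} (I : Fin v → Fin b → Bool) where

  open import Data.Nat using (_+_; _*_; _∸_)
  open import Algebra.Properties.CommutativeMonoid.Sum ℕ.+-0-commutativeMonoid
    using (sum; sum-cong-≗; ∑-comm)

  infix 4 _∈_
  _∈_ : Fin v → Fin b → Set
  α ∈ β = I α β ≡ true

  replication : Fin v → ℕ
  replication α = count (λ β → I α β)

  pt⁻¹ : Aut I → Fin v → Fin v
  pt⁻¹ g α = proj₁ (proj₂ (pt-bij g) α)

  pt-pt⁻¹ : ∀ (g : Aut I) α → pt g (pt⁻¹ g α) ≡ α
  pt-pt⁻¹ g α = proj₂ (proj₂ (pt-bij g) α) refl

  ∈-preserved : ∀ (g : Aut I) {α β} → α ∈ β → pt g α ∈ bl g β
  ∈-preserved g {α} {β} = trans (sym (preserves g α β))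

  module _ {k lam : ℕ} (D : Is2Design v b k lam I) where

    open Is2Design D

    block-through : ∀ {α α′} → α ≢ α′ → ∃ λ β → α ∈ β × α′ ∈ β
    block-through {α} {α′} α≢α′ with count-witness _ (subst (1 ≤_) (sym (pairCount α α′ α≢α′)) one≤lam)
    ... | β , αα′∈β = β , ∧-true αα′∈β
      where
      ∧-true : ∀ {x y} → x ∧ y ≡ true → x ≡ true × y ≡ true
      ∧-true {true} {true} _ = refl , refl

    pt₀ pt₁ : Fin v
    pt₀ = Fin.fromℕ< (ℕ.<-≤-trans (s≤s z≤n) two≤v)
    pt₁ = Fin.fromℕ< two≤v

    pt₀≢pt₁ : pt₀ ≢ pt₁
    pt₀≢pt₁ eq = contradiction (trans (sym (Fin.toℕ-fromℕ< _)) (trans (cong Fin.toℕ eq) (Fin.toℕ-fromℕ< _))) λ ()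

    2≤k : 2 ≤ k
    2≤k with β , pt₀∈β , pt₁∈β ← block-through pt₀≢pt₁ =
      subst (2 ≤_) (blockSize β) (two≤count (λ α → I α β) pt₀∈β pt₁∈β pt₀≢pt₁)

    point-on : ∀ β → ∃ λ α → α ∈ β
    point-on β = count-witness (λ α → I α β) (subst (1 ≤_) (sym (blockSize β)) (ℕ.<⇒≤ 2≤k))

    replication-identity : ∀ α → replication α * k ≡ replication α + (v ∸ 1) * lam
    replication-identity α = begin
      replication α * k                                            ≡⟨ sum-indicator (λ β → I α β) k ⟨
      sum {b} (λ β → indicator (I α β) k)                          ≡⟨ sum-cong-≗ blocks-through-α ⟨
      sum {b} (λ β → sum {v} (λ x → indicator (I α β ∧ I x β) 1))  ≡⟨ ∑-comm (λ β x → indicator (I α β ∧ I x β) 1) ⟩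
      sum {v} (λ x → sum {b} (λ β → indicator (I α β ∧ I x β) 1))  ≡⟨ sum-cong-≗ (λ x → sym (count≡sum (λ β → I α β ∧ I x β))) ⟩
      sum {v} (λ x → count (λ β → I α β ∧ I x β))                  ≡⟨ sum-const-except _ α pairs-through ⟩
      count (λ β → I α β ∧ I α β) + (v ∸ 1) * lam                  ≡⟨ cong (_+ (v ∸ 1) * lam) (count-cong (λ β → ∧-idem (I α β))) ⟩
      replication α + (v ∸ 1) * lam                                ∎
      where
      open ≡-Reasoning
      blocks-through-α : ∀ β → sum {v} (λ x → indicator (I α β ∧ I x β) 1) ≡ indicator (I α β) k
      blocks-through-α β with I α β
      ... | true  = trans (sym (count≡sum (λ x → I x β))) (blockSize β)
      ... | false = trans (sum-const v 0) (ℕ.*-zeroʳ v)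
      pairs-through : ∀ x → x ≢ α → count (λ β → I α β ∧ I x β) ≡ lam
      pairs-through x x≢α = pairCount α x (x≢α ∘ sym)

    incidences : b * k ≡ sum {v} replication
    incidences = begin
      b * k                                                ≡⟨ sum-const b k ⟨
      sum {b} (λ β → k)                                    ≡⟨ sum-cong-≗ (λ β → trans (sym (blockSize β)) (count≡sum (λ α → I α β))) ⟩
      sum {b} (λ β → sum {v} (λ α → indicator (I α β) 1))  ≡⟨ ∑-comm (λ β α → indicator (I α β) 1) ⟩
      sum {v} (λ α → sum {b} (λ β → indicator (I α β) 1))  ≡⟨ sum-cong-≗ (λ α → sym (count≡sum (λ β → I α β))) ⟩
      sum {v} replication                                  ∎
      where open ≡-Reasoning

    symmetric⇒k[k∸1]≡[v∸1]λ : v ≡ b → k * (k ∸ 1) ≡ (v ∸ 1) * lam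
    symmetric⇒k[k∸1]≡[v∸1]λ v≡b = trans (cong (_* (k ∸ 1)) k≡r₀) (r[k∸1]≡[v∸1]λ pt₀)
      where
      r[k∸1]≡[v∸1]λ : ∀ α → replication α * (k ∸ 1) ≡ (v ∸ 1) * lam
      r[k∸1]≡[v∸1]λ α = begin
        replication α * (k ∸ 1)                            ≡⟨ ℕ.*-distribˡ-∸ (replication α) k 1 ⟩
        replication α * k ∸ replication α * 1              ≡⟨ cong₂ _∸_ (replication-identity α) (ℕ.*-identityʳ (replication α)) ⟩
        replication α + (v ∸ 1) * lam ∸ replication α      ≡⟨ ℕ.m+n∸m≡n (replication α) _ ⟩
        (v ∸ 1) * lam                                      ∎
        where open ≡-Reasoning
      r-constant : ∀ α → replication α ≡ replication pt₀
      r-constant α = ℕ.*-cancelʳ-≡ _ _ (k ∸ 1) {{ℕ.>-nonZero (ℕ.∸-monoˡ-≤ 1 2≤k)}}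
                       (trans (r[k∸1]≡[v∸1]λ α) (sym (r[k∸1]≡[v∸1]λ pt₀)))
      k≡r₀ : k ≡ replication pt₀
      k≡r₀ = ℕ.*-cancelˡ-≡ k _ v {{ℕ.>-nonZero (ℕ.<-≤-trans (s≤s z≤n) two≤v)}} (begin
        v * k                            ≡⟨ cong (_* k) v≡b ⟩
        b * k                            ≡⟨ incidences ⟩
        sum {v} replication              ≡⟨ sum-cong-≗ r-constant ⟩
        sum {v} (λ _ → replication pt₀)  ≡⟨ sum-const v _ ⟩
        v * replication pt₀              ∎)
        where open ≡-Reasoning

  SamePoints : Fin b → Fin b → Set
  SamePoints β β′ = ∀ α → I α β ≡ I α β′

  samePoints-isDecEquivalence : IsDecEquivalence SamePoints
  samePoints-isDecEquivalence = record
    { isEquivalence = record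
      { refl  = λ _ → refl
      ; sym   = λ eq α → sym (eq α)
      ; trans = λ eq eq′ α → trans (eq α) (eq′ α) }
    ; _≟_ = λ β β′ → Fin.all? (λ α → I α β Bool.≟ I α β′) }

  samePoints-invariant : ∀ (h : Aut I) β β′ → SamePoints β β′ ⇔ SamePoints (bl h β) (bl h β′)
  samePoints-invariant h β β′ = mk⇔
    (λ same x → begin
      I x (bl h β)                    ≡⟨ cong (λ y → I y (bl h β)) (pt-pt⁻¹ h x) ⟨
      I (pt h (pt⁻¹ h x)) (bl h β)    ≡⟨ preserves h _ β ⟨
      I (pt⁻¹ h x) β                  ≡⟨ same (pt⁻¹ h x) ⟩
      I (pt⁻¹ h x) β′                 ≡⟨ preserves h _ β′ ⟩
      I (pt h (pt⁻¹ h x)) (bl h β′)   ≡⟨ cong (λ y → I y (bl h β′)) (pt-pt⁻¹ h x) ⟩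
      I x (bl h β′)                   ∎)
    (λ same x → trans (preserves h x β) (trans (same (pt h x)) (sym (preserves h x β′))))
    where open ≡-Reasoning

  module _ {k lam : ℕ} (D : Is2Design v b k lam I) (k<v : k < v) {G : Aut I → Set} (LP : LocallyPrimitive G) where

    open Is2Design D

    blocks-determined-by-points : ∀ {β β′} → SamePoints β β′ → β ≡ β′
    blocks-determined-by-points {β} {β′} same
      with α , α∈β ← point-on D β
      with primitive-dichotomy (proj₁ LP α) samePoints-isDecEquivalence (λ h β β′ _ → samePoints-invariant h β β′)
    ... | inj₁ discrete  = discrete α∈β (trans (sym (same α)) α∈β) same
    ... | inj₂ universal = contradiction (trans (sym (count-all (λ x → I x β) every-point-on-β)) (blockSize β)) (ℕ.<⇒≢ k<v ∘ sym)
      where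
      every-point-on-β : ∀ x → x ∈ β
      every-point-on-β x with α Fin.≟ x
      ... | yes refl = α∈β
      ... | no α≢x with γ , α∈γ , x∈γ ← block-through D α≢x = trans (universal α∈β α∈γ x) x∈γ

    bl-determined-by-pt : ∀ (g h : Aut I) → (∀ α → pt g α ≡ pt h α) → ∀ β → bl g β ≡ bl h β
    bl-determined-by-pt g h g≗h β = blocks-determined-by-points λ x → begin
      I x (bl g β)                    ≡⟨ cong (λ y → I y (bl g β)) (pt-pt⁻¹ g x) ⟨
      I (pt g (pt⁻¹ g x)) (bl g β)    ≡⟨ preserves g _ β ⟨
      I (pt⁻¹ g x) β                  ≡⟨ preserves h _ β ⟩
      I (pt h (pt⁻¹ g x)) (bl h β)    ≡⟨ cong (λ y → I y (bl h β)) (trans (sym (g≗h _)) (pt-pt⁻¹ g x)) ⟩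
      I x (bl h β)                    ∎
      where open ≡-Reasoning

    pt-id⇒bl-id : ∀ (g : Aut I) → (∀ α → pt g α ≡ α) → ∀ β → bl g β ≡ β
    pt-id⇒bl-id g g≗id β = blocks-determined-by-points λ x →
      trans (cong (λ y → I y (bl g β)) (sym (g≗id x))) (sym (preserves g x β))

  record AutInverse (g h : Aut I) : Set where
    field
      pt-left  : ∀ α → pt h (pt g α) ≡ α
      bl-left  : ∀ β → bl h (bl g β) ≡ β
      pt-right : ∀ α → pt g (pt h α) ≡ α

  ∃-inverse : ∀ {H : Aut I → Set} → IsSubgroup H → ∀ {g} → H g → ∃ λ h → H h × AutInverse g h
  ∃-inverse H-subgroup {g} Hg
    with e , _ , e-id ← IsSubgroup.hasId H-subgroup
    with h , Hh , h∘g≡e ← IsSubgroup.inv H-subgroup g Hg = h , Hh , record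
      { pt-left  = pt-left
      ; bl-left  = λ β → trans (sym (proj₂ (h∘g≡e e e-id) β)) (proj₂ e-id β)
      ; pt-right = λ α → trans (cong (pt g ∘ pt h) (sym (pt-pt⁻¹ g α))) (trans (cong (pt g) (pt-left _)) (pt-pt⁻¹ g α))
      }
    where
    pt-left : ∀ α → pt h (pt g α) ≡ α
    pt-left α = trans (sym (proj₁ (h∘g≡e e e-id) α)) (proj₁ e-id α)

module AffineDesign {v b k lam : ℕ} {I : Fin v → Fin b → Bool} (D : Is2Design v b k lam I) (k<v : k < v)
               {G : Aut I → Set} (G-subgroup : IsSubgroup G) (LP : LocallyPrimitive G)
               {p d : ℕ} .{{_ : NonZero p}} (PA : PrimitiveAffineOnPoints p {I = I} d G) where

  open import Data.Nat using (_*_; _∸_; _^_)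
  open Incidence I
  open Vectors p
  open ZMod p using (-_; 1#)

  φ : Fin v → Vect p d
  φ = proj₁ PA

  φ-injective : ∀ {α α′} → φ α ≈ φ α′ → α ≡ α′
  φ-injective = proj₁ (proj₁ (proj₂ PA))

  φ⁻¹ : Vect p d → Fin v
  φ⁻¹ e = proj₁ (proj₂ (proj₁ (proj₂ PA)) e)

  φ-φ⁻¹ : ∀ e → φ (φ⁻¹ e) ≈ e
  φ-φ⁻¹ e = proj₂ (proj₂ (proj₁ (proj₂ PA)) e) refl

  φ-cong : ∀ {α α′} → α ≡ α′ → φ α ≈ φ α′
  φ-cong refl = ≈-refl

  φ⁻¹-φ : ∀ α → φ⁻¹ (φ α) ≡ α
  φ⁻¹-φ α = φ-injective (φ-φ⁻¹ (φ α))

  φ⁻¹-cong : ∀ {e e′} → e ≈ e′ → φ⁻¹ e ≡ φ⁻¹ e′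
  φ⁻¹-cong e≈e′ = φ-injective (≈-trans (φ-φ⁻¹ _) (≈-trans e≈e′ (≈-sym (φ-φ⁻¹ _))))

  G-primitive : PrimitiveOn G pt allTrue
  G-primitive = proj₂ (proj₂ (proj₂ (proj₂ PA)))

  record Translation (g : Aut I) (e : Vect p d) : Set where
    constructor translation
    field translates : ∀ α → φ (pt g α) ≈ φ α +ᵥ e

  open Translation

  τ : Vect p d → Aut I
  τ e = proj₁ (proj₁ (proj₂ (proj₂ (proj₂ PA))) e)

  τ∈G : ∀ e → G (τ e)
  τ∈G e = proj₁ (proj₂ (proj₁ (proj₂ (proj₂ (proj₂ PA))) e))

  τ-translation : ∀ e → Translation (τ e) e
  τ-translation e = translation (proj₂ (proj₂ (proj₁ (proj₂ (proj₂ (proj₂ PA))) e)))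

  module _ {g : Aut I} where

    translation-resp : ∀ {e e′} → e ≈ e′ → Translation g e → Translation g e′
    translation-resp e≈e′ g-e = translation λ α → ≈-trans (translates g-e α) (∙-cong ≈-refl e≈e′)

    translation-pt-unique : ∀ {h e e′} → Translation g e → Translation h e′ → e ≈ e′ → ∀ α → pt g α ≡ pt h α
    translation-pt-unique g-e h-e′ e≈e′ α =
      φ-injective (≈-trans (translates g-e α) (≈-trans (∙-cong ≈-refl e≈e′) (≈-sym (translates h-e′ α))))

    translation-comp : ∀ {k h e e′} → (∀ α → pt k α ≡ pt g (pt h α)) →
                       Translation g e → Translation h e′ → Translation k (e′ +ᵥ e)
    translation-comp k≡g∘h g-e h-e′ = translation λ α →
      ≈-trans (φ-cong (k≡g∘h α)) (≈-trans (translates g-e _) (≈-trans (∙-cong (translates h-e′ α) ≈-refl) (assoc _ _ _)))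

    translation-inverse : ∀ {h e} → (∀ α → pt g (pt h α) ≡ α) → Translation g e → Translation h (-ᵥ e)
    translation-inverse {h} {e} g∘h≡id g-e = translation λ α →
      ≈-sym (x≈y∙z⇒x-y≈z (≈-trans (≈-sym (φ-cong (g∘h≡id α))) (≈-trans (translates g-e (pt h α)) (comm _ e))))

    translation-id : (∀ α → pt g α ≡ α) → Translation g 0ᵥ
    translation-id g≡id = translation λ α → ≈-trans (φ-cong (g≡id α)) (≈-sym (identityʳ (φ α)))

    translation-0 : ∀ {e} → Translation g e → e ≈ 0ᵥ → ∀ α → pt g α ≡ α
    translation-0 g-e e≈0 α = φ-injective (≈-trans (translates g-e α) (≈-trans (∙-cong ≈-refl e≈0) (identityʳ (φ α))))

    translation-moves : ∀ {x y} → Translation g (φ y -ᵥ φ x) → pt g x ≡ y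
    translation-moves {x} {y} g-e = φ-injective (≈-trans (translates g-e x) (x∙[y-x]≈y (φ x) (φ y)))

  record MapsDifference (g : Aut I) (a c : Vect p d) : Set where
    constructor mapsDifference
    field maps : ∀ x y → φ y ≈ φ x +ᵥ a → φ (pt g y) ≈ φ (pt g x) +ᵥ c

  open MapsDifference

  linearPart : ∀ {g} → G g → Mat p d
  linearPart {g} g∈G = proj₁ (proj₁ (proj₂ (proj₂ PA)) g g∈G)

  translationPart : ∀ {g} → G g → Vect p d
  translationPart {g} g∈G = proj₁ (proj₂ (proj₂ (proj₁ (proj₂ (proj₂ PA)) g g∈G)))

  affine : ∀ {g} (g∈G : G g) α → φ (pt g α) ≈ linearPart g∈G ·ᴹ φ α +ᵥ translationPart g∈G
  affine {g} g∈G = proj₂ (proj₂ (proj₂ (proj₁ (proj₂ (proj₂ PA)) g g∈G)))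

  linearPart-maps : ∀ {g} (g∈G : G g) a → MapsDifference g a (linearPart g∈G ·ᴹ a)
  linearPart-maps {g} g∈G a = mapsDifference λ x y y≈x+a → begin
    φ (pt g y)                   ≈⟨ affine g∈G y ⟩
    A ·ᴹ φ y +ᵥ c                ≈⟨ ∙-cong (≈-trans (·-cong A y≈x+a) (·-+ᵥ A (φ x) a)) ≈-refl ⟩
    A ·ᴹ φ x +ᵥ A ·ᴹ a +ᵥ c      ≈⟨ xy∙z≈xz∙y _ _ _ ⟩
    A ·ᴹ φ x +ᵥ c +ᵥ A ·ᴹ a      ≈⟨ ∙-cong (affine g∈G x) ≈-refl ⟨
    φ (pt g x) +ᵥ A ·ᴹ a         ∎
    where
    open import Relation.Binary.Reasoning.Setoid setoid
    A = linearPart g∈G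
    c = translationPart g∈G

  mapsDifference-comp : ∀ {k g h a c e} → (∀ α → pt k α ≡ pt g (pt h α)) →
                        MapsDifference h a c → MapsDifference g c e → MapsDifference k a e
  mapsDifference-comp k≡g∘h h-a-c g-c-e = mapsDifference λ x y y≈x+a →
    ≈-trans (φ-cong (k≡g∘h y)) (≈-trans (maps g-c-e _ _ (maps h-a-c x y y≈x+a)) (∙-cong (φ-cong (sym (k≡g∘h x))) ≈-refl))

  mapsDifference-id : ∀ {g a} → (∀ α → pt g α ≡ α) → MapsDifference g a a
  mapsDifference-id g≡id = mapsDifference λ x y y≈x+a →
    ≈-trans (φ-cong (g≡id y)) (≈-trans y≈x+a (∙-cong (φ-cong (sym (g≡id x))) ≈-refl))

  mapsDifference-resp : ∀ {g a c c′} → c ≈ c′ → MapsDifference g a c → MapsDifference g a c′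
  mapsDifference-resp c≈c′ g-a-c = mapsDifference λ x y y≈x+a → ≈-trans (maps g-a-c x y y≈x+a) (∙-cong ≈-refl c≈c′)

  difference-from-0 : ∀ e → φ (φ⁻¹ e) -ᵥ φ (φ⁻¹ 0ᵥ) ≈ e
  difference-from-0 e = ≈-trans (∙-cong (φ-φ⁻¹ e) (-ᵥ-cong (φ-φ⁻¹ 0ᵥ))) (x-ε≈x e)

  conjugate-translation : ∀ {g e c} → MapsDifference g e c → ∀ α → pt g (pt (τ e) α) ≡ pt (τ c) (pt g α)
  conjugate-translation {g} {e} {c} g-e-c α =
    φ-injective (≈-trans (maps g-e-c α (pt (τ e) α) (translates (τ-translation e) α)) (≈-sym (translates (τ-translation c) (pt g α))))

  open Is2Design D

  _≈ᵀ_ : Fin b → Fin b → Set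
  γ ≈ᵀ γ′ = ∃ λ z → bl (τ (φ z)) γ ≡ γ′

  translation⇒≈ᵀ : ∀ {g e γ γ′} → Translation g e → bl g γ ≡ γ′ → γ ≈ᵀ γ′
  translation⇒≈ᵀ {g} {e} {γ} g-e gγ≡γ′ = φ⁻¹ e , trans (bl-determined-by-pt D k<v LP τ′ g τ′≗g γ) gγ≡γ′
    where
    τ′ = τ (φ (φ⁻¹ e))
    τ′≗g : ∀ α → pt τ′ α ≡ pt g α
    τ′≗g = translation-pt-unique (τ-translation (φ (φ⁻¹ e))) g-e (φ-φ⁻¹ e)

  ≈ᵀ-refl : ∀ {γ} → γ ≈ᵀ γ
  ≈ᵀ-refl {γ} with e , _ , e-id ← IsSubgroup.hasId G-subgroup =
    translation⇒≈ᵀ (translation-id {g = e} (proj₁ e-id)) (proj₂ e-id γ)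

  ≈ᵀ-sym : ∀ {γ γ′} → γ ≈ᵀ γ′ → γ′ ≈ᵀ γ
  ≈ᵀ-sym {γ} (z , τγ≡γ′) with h , _ , h-inv ← ∃-inverse G-subgroup (τ∈G (φ z)) =
    translation⇒≈ᵀ (translation-inverse {h = h} (AutInverse.pt-right h-inv) (τ-translation (φ z)))
                   (trans (cong (bl h) (sym τγ≡γ′)) (AutInverse.bl-left h-inv γ))

  ≈ᵀ-trans : ∀ {γ γ′ γ″} → γ ≈ᵀ γ′ → γ′ ≈ᵀ γ″ → γ ≈ᵀ γ″
  ≈ᵀ-trans {γ} (z , τγ≡γ′) (z′ , τγ′≡γ″)
    with k , _ , k≡ ← IsSubgroup.comp G-subgroup (τ (φ z′)) (τ (φ z)) (τ∈G _) (τ∈G _) =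
    translation⇒≈ᵀ (translation-comp {k = k} (proj₁ k≡) (τ-translation _) (τ-translation _))
                   (trans (proj₂ k≡ γ) (trans (cong (bl (τ (φ z′))) τγ≡γ′) τγ′≡γ″))

  ≈ᵀ-isDecEquivalence : IsDecEquivalence _≈ᵀ_
  ≈ᵀ-isDecEquivalence = record
    { isEquivalence = record { refl = ≈ᵀ-refl ; sym = ≈ᵀ-sym ; trans = ≈ᵀ-trans }
    ; _≟_ = λ γ γ′ → Fin.any? (λ z → bl (τ (φ z)) γ Fin.≟ γ′) }

  ≈ᵀ-invariant : ∀ {g} → G g → ∀ γ γ′ → γ ≈ᵀ γ′ ⇔ bl g γ ≈ᵀ bl g γ′
  ≈ᵀ-invariant {g} g∈G = λ γ γ′ → mk⇔ (forward g∈G) (backward γ γ′)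
    where
    forward : ∀ {g} → G g → ∀ {γ γ′} → γ ≈ᵀ γ′ → bl g γ ≈ᵀ bl g γ′
    forward {g} g∈G {γ} {γ′} (z , τγ≡γ′)
      with k₁ , _ , k₁≡ ← IsSubgroup.comp G-subgroup g (τ (φ z)) g∈G (τ∈G _)
      with k₂ , _ , k₂≡ ← IsSubgroup.comp G-subgroup (τ (linearPart g∈G ·ᴹ φ z)) g (τ∈G _) g∈G =
      translation⇒≈ᵀ (τ-translation _) (begin
        bl (τ _) (bl g γ)      ≡⟨ proj₂ k₂≡ γ ⟨
        bl k₂ γ                ≡⟨ bl-determined-by-pt D k<v LP k₂ k₁ k₂≡k₁ γ ⟩
        bl k₁ γ                ≡⟨ proj₂ k₁≡ γ ⟩
        bl g (bl (τ (φ z)) γ)  ≡⟨ cong (bl g) τγ≡γ′ ⟩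
        bl g γ′                ∎)
      where
      open ≡-Reasoning
      k₂≡k₁ : ∀ α → pt k₂ α ≡ pt k₁ α
      k₂≡k₁ α = trans (proj₁ k₂≡ α) (trans (sym (conjugate-translation (linearPart-maps g∈G (φ z)) α)) (sym (proj₁ k₁≡ α)))
    backward : ∀ γ γ′ → bl g γ ≈ᵀ bl g γ′ → γ ≈ᵀ γ′
    backward γ γ′ gγ≈gγ′ with h , h∈G , h-inv ← ∃-inverse G-subgroup g∈G =
      subst₂ _≈ᵀ_ (AutInverse.bl-left h-inv γ) (AutInverse.bl-left h-inv γ′) (forward h∈G gγ≈gγ′)

  translated-through : ∀ α γ → ∃ λ γ′ → α ∈ γ′ × γ ≈ᵀ γ′
  translated-through α γ with x , x∈γ ← point-on D γ =
    bl g γ , subst (_∈ bl g γ) (translation-moves (τ-translation _)) (∈-preserved g x∈γ) , translation⇒≈ᵀ (τ-translation _) refl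
    where g = τ (φ α -ᵥ φ x)

  translations-transitive : ∀ {α β e} → α ∈ β → α ∈ bl (τ e) β → bl (τ e) β ≢ β → ∀ γ γ′ → γ ≈ᵀ γ′
  translations-transitive {α} {β} {e} α∈β α∈τβ τβ≢β
    with primitive-dichotomy (proj₁ LP α) ≈ᵀ-isDecEquivalence (λ g γ γ′ g∈Gα → ≈ᵀ-invariant (proj₁ g∈Gα) γ γ′)
  ... | inj₁ discrete  = contradiction (sym (discrete α∈β α∈τβ (translation⇒≈ᵀ (τ-translation e) refl))) τβ≢β
  ... | inj₂ universal = λ γ γ′ →
    let (γ₁ , α∈γ₁ , γ≈γ₁) = translated-through α γ
        (γ₁′ , α∈γ₁′ , γ′≈γ₁′) = translated-through α γ′
    in ≈ᵀ-trans γ≈γ₁ (≈ᵀ-trans (universal α∈γ₁ α∈γ₁′) (≈ᵀ-sym γ′≈γ₁′))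

  -- Membership of a translation in an arbitrary normal subgroup H cannot be decided.  Since the goal
  -- is ⊥, we may instead decide classically, once for G, which differences its linear parts map
  -- to which; inside H we then work with the decidable span of the orbit of one translation.
  OrbitDecidable : Set
  OrbitDecidable = ∀ z z′ → Dec (∃ λ g → G g × MapsDifference g (φ z) (φ z′))

  ¬¬-orbitDecidable : ¬ ¬ OrbitDecidable
  ¬¬-orbitDecidable = Fin.sequence ¬¬-applicative λ z → Fin.sequence ¬¬-applicative λ z′ → ¬¬-excluded-middle
    where ¬¬-applicative = RawMonad.rawApplicative ¬¬-Monad

  module NormalSubgroup (decide-orbit : OrbitDecidable) {H : Aut I → Set} (H-normal : IsNormalSubgroup G H)
                        {h₀ : Aut I} (h₀∈H : H h₀) {β₀ : Fin b} (h₀-moves-β₀ : bl h₀ β₀ ≢ β₀) where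

    open IsNormalSubgroup H-normal

    TranslationInH : Vect p d → Set
    TranslationInH e = ∃ λ h → H h × Translation h e

    translationInH-isSubspace : IsSubspace TranslationInH
    translationInH-isSubspace = record
      { ∈-resp = λ { e≈e′ (h , h∈H , h-e) → h , h∈H , translation-resp e≈e′ h-e }
      ; 0∈     = let (e , e∈H , e-id) = IsSubgroup.hasId subgroup in e , e∈H , translation-id {g = e} (proj₁ e-id)
      ; +∈     = λ { {e} {e′} (h , h∈H , h-e) (h′ , h′∈H , h′-e′) →
                   let (k , k∈H , k≡) = IsSubgroup.comp subgroup h h′ h∈H h′∈H
                   in k , k∈H , translation-resp (comm e′ e) (translation-comp {k = k} (proj₁ k≡) h-e h′-e′) }
      }

    open IsSubspace translationInH-isSubspace using () renaming (0∈ to 0∈H)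

    translationInH-conjugate : ∀ {g e c} → G g → MapsDifference g e c → TranslationInH e → TranslationInH c
    translationInH-conjugate {g} {e} {c} g∈G g-e-c (h , h∈H , h-e)
      with h′ , h′∈H , h′∘g≡g∘h , _ ← normal g h g∈G h∈H = h′ , h′∈H , translation λ α → begin
        φ (pt h′ α)                     ≈⟨ φ-cong (cong (pt h′) (pt-pt⁻¹ g α)) ⟨
        φ (pt h′ (pt g (pt⁻¹ g α)))     ≈⟨ φ-cong (h′∘g≡g∘h _) ⟩
        φ (pt g (pt h (pt⁻¹ g α)))      ≈⟨ MapsDifference.maps g-e-c _ _ (translates h-e _) ⟩
        φ (pt g (pt⁻¹ g α)) +ᵥ c        ≈⟨ ∙-cong (φ-cong (pt-pt⁻¹ g α)) ≈-refl ⟩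
        φ α +ᵥ c                        ∎
      where open import Relation.Binary.Reasoning.Setoid setoid

    h₀∈G : G h₀
    h₀∈G = sub h₀ h₀∈H

    A₀ : Mat p d
    A₀ = linearPart h₀∈G

    -- realised by the commutator of h₀ with τ e
    commutator-inH : ∀ e → TranslationInH (e -ᵥ A₀ ·ᴹ e)
    commutator-inH e
      with h′ , h′∈H , h′∘τ≡τ∘h₀ , _ ← normal (τ e) h₀ (τ∈G e) h₀∈H
      with h₀⁻¹ , h₀⁻¹∈H , h₀-inv ← ∃-inverse subgroup h₀∈H
      with k , k∈H , k≡ ← IsSubgroup.comp subgroup h′ h₀⁻¹ h′∈H h₀⁻¹∈H = k , k∈H , translation λ y →
        let x = pt h₀⁻¹ y
            u = pt⁻¹ (τ e) x
            h₀τu≡y = trans (cong (pt h₀) (pt-pt⁻¹ (τ e) x)) (AutInverse.pt-right h₀-inv y)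
        in begin
          φ (pt k y)                                ≈⟨ φ-cong (trans (proj₁ k≡ y) (cong (pt h′) (sym (pt-pt⁻¹ (τ e) x)))) ⟩
          φ (pt h′ (pt (τ e) u))                    ≈⟨ φ-cong (h′∘τ≡τ∘h₀ u) ⟩
          φ (pt (τ e) (pt h₀ u))                    ≈⟨ translates (τ-translation e) _ ⟩
          φ (pt h₀ u) +ᵥ e                          ≈⟨ [x∙y]∙[z-y]≈x∙z _ _ e ⟨
          (φ (pt h₀ u) +ᵥ A₀ ·ᴹ e) +ᵥ (e -ᵥ A₀ ·ᴹ e) ≈⟨ ∙-cong h₀τu≈ ≈-refl ⟨
          φ (pt h₀ (pt (τ e) u)) +ᵥ (e -ᵥ A₀ ·ᴹ e)   ≈⟨ ∙-cong (φ-cong h₀τu≡y) ≈-refl ⟩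
          φ y +ᵥ (e -ᵥ A₀ ·ᴹ e)                     ∎
      where
      open import Relation.Binary.Reasoning.Setoid setoid
      h₀τu≈ : ∀ {u} → φ (pt h₀ (pt (τ e) u)) ≈ φ (pt h₀ u) +ᵥ A₀ ·ᴹ e
      h₀τu≈ {u} = MapsDifference.maps (linearPart-maps h₀∈G e) u _ (translates (τ-translation e) u)

    nonzero-inH : ∃ λ e → TranslationInH e × ¬ e ≈ 0ᵥ
    nonzero-inH with Fin.any? (λ z → ¬? (A₀ ·ᴹ φ z ≈? φ z))
    ... | yes (z , A₀z≉z) =
      φ z -ᵥ A₀ ·ᴹ φ z , commutator-inH (φ z) , λ z-A₀z≈0 → A₀z≉z (≈-sym (x∙y⁻¹≈ε⇒x≈y (φ z) _ z-A₀z≈0))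
    ... | no ¬∃A₀z≉z = translationPart h₀∈G , (h₀ , h₀∈H , h₀-translation) , λ c₀≈0 →
      h₀-moves-β₀ (pt-id⇒bl-id D k<v LP h₀ (translation-0 h₀-translation c₀≈0) β₀)
      where
      A₀-fixes : ∀ z → A₀ ·ᴹ φ z ≈ φ z
      A₀-fixes z with A₀ ·ᴹ φ z ≈? φ z
      ... | yes A₀z≈z = A₀z≈z
      ... | no A₀z≉z  = contradiction (z , A₀z≉z) ¬∃A₀z≉z
      h₀-translation : Translation h₀ (translationPart h₀∈G)
      h₀-translation = translation λ α → ≈-trans (affine h₀∈G α) (∙-cong (A₀-fixes α) ≈-refl)

    e₀ : Vect p d
    e₀ = proj₁ nonzero-inH

    z₀ : Fin v
    z₀ = φ⁻¹ e₀

    -- the orbit of e₀ under the linear parts of G, indexed by points (0ᵥ off the orbit)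
    orbit : Fin v → Vect p d
    orbit z with decide-orbit z₀ z
    ... | yes _ = φ z
    ... | no _  = 0ᵥ

    orbit-member : ∀ {g z} → G g → MapsDifference g (φ z₀) (φ z) → orbit z ≈ φ z
    orbit-member {g} {z} g∈G g-maps with decide-orbit z₀ z
    ... | yes _      = ≈-refl
    ... | no ¬member = contradiction (g , g∈G , g-maps) ¬member

    orbit-inH : ∀ z → TranslationInH (orbit z)
    orbit-inH z with decide-orbit z₀ z
    ... | yes (g , g∈G , g-maps) = translationInH-conjugate g∈G g-maps
                                     (IsSubspace.∈-resp translationInH-isSubspace (≈-sym (φ-φ⁻¹ e₀)) (proj₁ (proj₂ nonzero-inH)))
    ... | no _ = 0∈H

    OrbitSpan : Vect p d → Set
    OrbitSpan = Span orbit

    open IsSubspace (span-isSubspace orbit)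

    e₀∈orbitSpan : OrbitSpan e₀
    e₀∈orbitSpan with e , e∈G , e-id ← IsSubgroup.hasId G-subgroup =
      ∈-resp (≈-trans (orbit-member e∈G (mapsDifference-id {g = e} (proj₁ e-id))) (φ-φ⁻¹ e₀)) (generator∈span orbit z₀)

    orbitSpan-invariant : ∀ {g} (g∈G : G g) {e} → OrbitSpan e → OrbitSpan (linearPart g∈G ·ᴹ e)
    orbitSpan-invariant {g} g∈G = span-minimal orbit preimage-isSubspace generator-image
      where
      A = linearPart g∈G
      preimage-isSubspace : IsSubspace (λ e → OrbitSpan (A ·ᴹ e))
      preimage-isSubspace = record
        { ∈-resp = ∈-resp ∘ ·-cong A
        ; 0∈     = ∈-resp (≈-sym (·-0ᵥ A)) 0∈
        ; +∈     = λ {x} {y} Ax Ay → ∈-resp (≈-sym (·-+ᵥ A x y)) (+∈ Ax Ay)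
        }
      generator-image : ∀ z → OrbitSpan (A ·ᴹ orbit z)
      generator-image z with decide-orbit z₀ z
      ... | no _ = ∈-resp (≈-sym (·-0ᵥ A)) 0∈
      ... | yes (g′ , g′∈G , g′-maps) with k , k∈G , k≡ ← IsSubgroup.comp G-subgroup g g′ g∈G g′∈G =
        ∈-resp (≈-trans (orbit-member k∈G k-maps) (φ-φ⁻¹ _)) (generator∈span orbit _)
        where
        k-maps : MapsDifference k (φ z₀) (φ (φ⁻¹ (A ·ᴹ φ z)))
        k-maps = mapsDifference-resp (≈-sym (φ-φ⁻¹ _)) (mapsDifference-comp (proj₁ k≡) g′-maps (linearPart-maps g∈G (φ z)))

    orbitSpan⊆inH : ∀ {e} → OrbitSpan e → TranslationInH e
    orbitSpan⊆inH = span-minimal orbit translationInH-isSubspace orbit-inH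

    _∼_ : Fin v → Fin v → Set
    x ∼ y = OrbitSpan (φ y -ᵥ φ x)

    ∼-isDecEquivalence : IsDecEquivalence _∼_
    ∼-isDecEquivalence = record
      { isEquivalence = record
        { refl  = λ {x} → ∈-resp (≈-sym (inverseʳ (φ x))) 0∈
        ; sym   = λ {x} {y} x∼y → ∈-resp (-1*[y-x]≈x-y (φ x) (φ y)) (*∈ (- 1#) x∼y)
        ; trans = λ {x} {y} {z} x∼y y∼z → ∈-resp ([y-x]∙[z-y]≈z-x (φ x) (φ y) (φ z)) (+∈ x∼y y∼z) }
      ; _≟_ = λ x y → span? orbit (φ y -ᵥ φ x) }

    ∼-invariant : ∀ g x y → G g → x ∼ y ⇔ pt g x ∼ pt g y
    ∼-invariant g x y g∈G = mk⇔ (forward g∈G) backward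
      where
      forward : ∀ {g x y} → G g → x ∼ y → pt g x ∼ pt g y
      forward {g} {x} {y} g∈G x∼y = ∈-resp (≈-sym (x≈y∙z⇒x-y≈z g-maps)) (orbitSpan-invariant g∈G x∼y)
        where
        g-maps = MapsDifference.maps (linearPart-maps g∈G (φ y -ᵥ φ x)) x y (≈-sym (x∙[y-x]≈y (φ x) (φ y)))
      backward : pt g x ∼ pt g y → x ∼ y
      backward gx∼gy with h , h∈G , g-inv ← ∃-inverse G-subgroup g∈G =
        subst₂ _∼_ (AutInverse.pt-left g-inv x) (AutInverse.pt-left g-inv y) (forward h∈G gx∼gy)

    0∼e₀ : φ⁻¹ 0ᵥ ∼ φ⁻¹ e₀
    0∼e₀ = ∈-resp (≈-sym (difference-from-0 e₀)) e₀∈orbitSpan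

    all-translations-inH : ∀ e → TranslationInH e
    all-translations-inH e = case primitive-dichotomy G-primitive ∼-isDecEquivalence ∼-invariant of λ where
      (inj₁ discrete)  → contradiction (≈-trans (≈-sym (φ-φ⁻¹ e₀)) (≈-trans (φ-cong (sym (discrete refl refl 0∼e₀))) (φ-φ⁻¹ 0ᵥ)))
                                       (proj₂ (proj₂ nonzero-inH))
      (inj₂ universal) → orbitSpan⊆inH (∈-resp (difference-from-0 e) (universal {φ⁻¹ 0ᵥ} {φ⁻¹ e} refl refl))

    H-transitive : (∀ γ γ′ → γ ≈ᵀ γ′) → TransitiveOn H bl allTrue
    H-transitive T-transitive γ γ′ _ _ =
      let (z , τγ≡γ′) = T-transitive γ γ′
          (h , h∈H , h-translation) = all-translations-inH (φ z)
          h≗τ = translation-pt-unique h-translation (τ-translation (φ z)) ≈-refl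
      in h , h∈H , trans (bl-determined-by-pt D k<v LP h (τ (φ z)) h≗τ γ) τγ≡γ′

  quasiprimitive-if-translations-transitive : (∀ γ γ′ → γ ≈ᵀ γ′) → ¬ ¬ BlockQuasiprimitive G
  quasiprimitive-if-translations-transitive T-transitive ¬quasiprimitive = ¬¬-orbitDecidable λ decide-orbit →
    ¬quasiprimitive (G-transitive , λ H H-normal (h₀ , h₀∈H , β₀ , h₀-moves-β₀) →
      NormalSubgroup.H-transitive decide-orbit H-normal h₀∈H h₀-moves-β₀ T-transitive)
    where
    G-transitive : TransitiveOn G bl allTrue
    G-transitive γ γ′ _ _ = let (z , τγ≡γ′) = T-transitive γ γ′ in τ (φ z) , τ∈G _ , τγ≡γ′

  translation-fixes-block : ¬ BlockQuasiprimitive G → ∀ {α β e} → α ∈ β → α ∈ bl (τ e) β → bl (τ e) β ≡ β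
  translation-fixes-block ¬quasiprimitive {α} {β} {e} α∈β α∈τβ = case bl (τ e) β Fin.≟ β of λ where
    (yes τβ≡β) → τβ≡β
    (no τβ≢β)  → contradiction ¬quasiprimitive
                   (quasiprimitive-if-translations-transitive (translations-transitive α∈β α∈τβ τβ≢β))

  module Cosets (p-prime : Prime p) (¬quasiprimitive : ¬ BlockQuasiprimitive G) where

    block-closed : ∀ {β x y z} → x ∈ β → y ∈ β → z ∈ β → φ⁻¹ (φ z +ᵥ (φ y -ᵥ φ x)) ∈ β
    block-closed {β} {x} {y} {z} x∈β y∈β z∈β = subst (_∈ β) gz≡ (subst (pt g z ∈_) gβ≡β (∈-preserved g z∈β))
      where
      g = τ (φ y -ᵥ φ x)
      gβ≡β : bl g β ≡ β
      gβ≡β = translation-fixes-block ¬quasiprimitive y∈β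
               (subst (_∈ bl g β) (translation-moves (τ-translation _)) (∈-preserved g x∈β))
      gz≡ : pt g z ≡ φ⁻¹ (φ z +ᵥ (φ y -ᵥ φ x))
      gz≡ = φ-injective (≈-trans (translates (τ-translation _) z) (≈-sym (φ-φ⁻¹ _)))

    base : Fin b → Vect p d
    base β = φ (proj₁ (point-on D β))

    Direction : Fin b → Vect p d → Set
    Direction β e = φ⁻¹ (base β +ᵥ e) ∈ β

    direction-isSubspace : ∀ β → IsSubspace (Direction β)
    direction-isSubspace β = record
      { ∈-resp = λ e≈e′ → subst (_∈ β) (φ⁻¹-cong (∙-cong ≈-refl e≈e′))
      ; 0∈     = subst (_∈ β) (trans (sym (φ⁻¹-φ _)) (φ⁻¹-cong (≈-sym (identityʳ (base β))))) (proj₂ (point-on D β))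
      ; +∈     = λ {e} {e′} e∈ e′∈ → subst (_∈ β) (φ⁻¹-cong (sum≈ e e′)) (block-closed (proj₂ (point-on D β)) e∈ e′∈)
      }
      where
      open import Relation.Binary.Reasoning.Setoid setoid
      w = base β
      sum≈ : ∀ e e′ → φ (φ⁻¹ (w +ᵥ e′)) +ᵥ (φ (φ⁻¹ (w +ᵥ e)) -ᵥ w) ≈ w +ᵥ (e +ᵥ e′)
      sum≈ e e′ = begin
        φ (φ⁻¹ (w +ᵥ e′)) +ᵥ (φ (φ⁻¹ (w +ᵥ e)) -ᵥ w)  ≈⟨ ∙-cong (φ-φ⁻¹ _) (x≈y∙z⇒x-y≈z (φ-φ⁻¹ _)) ⟩
        w +ᵥ e′ +ᵥ e                                  ≈⟨ assoc w e′ e ⟩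
        w +ᵥ (e′ +ᵥ e)                                ≈⟨ ∙-cong ≈-refl (comm e′ e) ⟩
        w +ᵥ (e +ᵥ e′)                                ∎

    directionBasis : ∀ β → Basis (Direction β)
    directionBasis β = basis p-prime (direction-isSubspace β) (λ e → I (φ⁻¹ (base β +ᵥ e)) β Bool.≟ true)

    dim : Fin b → ℕ
    dim β = Basis.dim (directionBasis β)

    on-block⇔coset : ∀ β α → α ∈ β ⇔ ∃ λ c → φ α ≈ base β +ᵥ lincomb p c (Basis.vector (directionBasis β))
    on-block⇔coset β α = mk⇔
      (λ α∈β → let (c , eq) = spans (subst (_∈ β) (sym α≡) α∈β) in
                 c , ≈-trans (≈-sym (x∙[y-x]≈y w (φ α))) (∙-cong ≈-refl eq))
      (λ (c , eq) → subst (_∈ β) (trans (φ⁻¹-cong (≈-sym eq)) (φ⁻¹-φ α)) (lincomb∈ vector vector∈ c))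
      where
      open Basis (directionBasis β) hiding (dim)
      open IsSubspace (direction-isSubspace β)
      w = base β
      α≡ : φ⁻¹ (w +ᵥ (φ α -ᵥ w)) ≡ α
      α≡ = trans (φ⁻¹-cong (x∙[y-x]≈y w (φ α))) (φ⁻¹-φ α)

    k≡p^dim : ∀ β → k ≡ p ^ dim β
    k≡p^dim β = trans (sym (blockSize β)) (count-bijection (λ α → I α β) F F-injective F-true F-complete)
      where
      open Basis (directionBasis β) hiding (dim)
      w = base β
      coords : Fin (p ^ dim β) → Vect p (dim β)
      coords = Fin.finToFun
      index : Vect p (dim β) → Fin (p ^ dim β)
      index = Fin.funToFin
      F : Fin (p ^ dim β) → Fin v
      F n = φ⁻¹ (w +ᵥ lincomb p (coords n) vector)
      F-injective : ∀ {n n′} → F n ≡ F n′ → n ≡ n′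
      F-injective {n} {n′} Fn≡Fn′ = begin
        n                   ≡⟨ Fin.funToFin-finToFin {dim β} {p} n ⟨
        index (coords n)    ≡⟨ funToFin-cong (lincomb-injective independent (∙-cancelˡ w _ _ w+≈)) ⟩
        index (coords n′)   ≡⟨ Fin.funToFin-finToFin {dim β} {p} n′ ⟩
        n′                  ∎
        where
        open ≡-Reasoning
        w+≈ = ≈-trans (≈-sym (φ-φ⁻¹ _)) (≈-trans (φ-cong Fn≡Fn′) (φ-φ⁻¹ _))
      F-true : ∀ n → F n ∈ β
      F-true n = Equivalence.from (on-block⇔coset β (F n)) (coords n , φ-φ⁻¹ _)
      F-complete : ∀ α → α ∈ β → ∃ λ n → F n ≡ α
      F-complete α α∈β = let (c , eq) = Equivalence.to (on-block⇔coset β α) α∈β in index c , (begin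
        F (index c)                       ≡⟨ φ⁻¹-cong (∙-cong ≈-refl (lincomb-cong vector (Fin.finToFun-funToFin c))) ⟩
        φ⁻¹ (w +ᵥ lincomb p c vector)     ≡⟨ φ⁻¹-cong (≈-sym eq) ⟩
        φ⁻¹ (φ α)                         ≡⟨ φ⁻¹-φ α ⟩
        α                                 ∎)
        where open ≡-Reasoning

    v≡p^d : v ≡ p ^ d
    v≡p^d = trans (sym (count-all (λ _ → true) (λ _ → refl)))
                  (count-bijection (λ _ → true) (φ⁻¹ ∘ coords) F-injective (λ _ → refl) F-complete)
      where
      coords : Fin (p ^ d) → Vect p d
      coords = Fin.finToFun
      F-injective : ∀ {n n′} → φ⁻¹ (coords n) ≡ φ⁻¹ (coords n′) → n ≡ n′
      F-injective {n} {n′} eq = begin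
        n                             ≡⟨ Fin.funToFin-finToFin {d} {p} n ⟨
        Fin.funToFin (coords n)       ≡⟨ funToFin-cong (≈-trans (≈-sym (φ-φ⁻¹ _)) (≈-trans (φ-cong eq) (φ-φ⁻¹ _))) ⟩
        Fin.funToFin (coords n′)      ≡⟨ Fin.funToFin-finToFin {d} {p} n′ ⟩
        n′                            ∎
        where open ≡-Reasoning
      F-complete : ∀ α → true ≡ true → ∃ λ n → φ⁻¹ (coords n) ≡ α
      F-complete α _ = Fin.funToFin (φ α) , trans (φ⁻¹-cong (Fin.finToFun-funToFin (φ α))) (φ⁻¹-φ α)

    1<p : 1 < p
    1<p = ℕ.nonTrivial⇒n>1 p {{prime⇒nonTrivial p-prime}}

    β₀ : Fin b
    β₀ = proj₁ (block-through D (pt₀≢pt₁ D))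

    i : ℕ
    i = dim β₀

    dim-constant : ∀ β → dim β ≡ i
    dim-constant β = ^-injective 1<p (trans (sym (k≡p^dim β)) (k≡p^dim β₀))

    1≤i : 1 ≤ i
    1≤i = ^-reflects-< 1<p (subst (1 <_) (k≡p^dim β₀) (2≤k D))

    i<d : i < d
    i<d = ^-reflects-< 1<p (subst₂ _<_ (k≡p^dim β₀) v≡p^d k<v)

    subdesign : SubdesignAG p {I = I} d i
    subdesign = φ , proj₁ (proj₂ PA) , (λ β → subst (CosetOf β) (dim-constant β) (coset β)) ,
                λ β β′ same → blocks-determined-by-points D k<v LP same
      where
      CosetOf : Fin b → ℕ → Set
      CosetOf β j = ∃ λ (u : Fin j → Vect p d) → LinIndep p u × ∃ λ w → ∀ α →
                      (α ∈ β → ∃ λ c → φ α ≈ w +ᵥ lincomb p c u) × ((∃ λ c → φ α ≈ w +ᵥ lincomb p c u) → α ∈ β)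
      coset : ∀ β → CosetOf β (dim β)
      coset β = Basis.vector (directionBasis β) , Basis.independent (directionBasis β) , base β ,
                λ α → Equivalence.to (on-block⇔coset β α) , Equivalence.from (on-block⇔coset β α)

    not-symmetric : v ≢ b
    not-symmetric v≡b = p^i[p^i∸1]≢[p^d∸1]λ lam 1<p 1≤i i<d
      (subst₂ (λ k′ v′ → k′ * (k′ ∸ 1) ≡ (v′ ∸ 1) * lam) (k≡p^dim β₀) v≡p^d (symmetric⇒k[k∸1]≡[v∸1]λ D v≡b))

lemma7p2 : (v b k lam : ℕ) (I : Fin v → Fin b → Bool) →
    Is2Design v b k lam I → k < v →
    (G : Aut I → Set) → IsSubgroup G → LocallyPrimitive G →
    (p d : ℕ) .{{_ : NonZero p}} → Prime p → 1 ≤ d →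
    PrimitiveAffineOnPoints p {I = I} d G →
    ¬ BlockQuasiprimitive G →
    (∃ λ i → 1 ≤ i × i < d × SubdesignAG p {I = I} d i) × v ≢ b
lemma7p2 v b k lam I D k<v G G-subgroup LP p d p-prime _ PA ¬quasiprimitive =
  (i , 1≤i , i<d , subdesign) , not-symmetric
  where
  open AffineDesign D k<v G-subgroup LP PA
  open Cosets p-prime ¬quasiprimitive
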